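{- Let $n\ge 3$ be an integer and let $P(G(n))$ be the power graph of the gyrogroup $(G(n),\oplus)$ described in the context. Then $P(G(n))$ is planar if $n=3$ and non-planar if $n\ge 4$.
   Context: Let $n\ge 3$ and $m=2^{n-1}$. Put $P(n)=\{0,1,\dots,m-1\}$, $H(n)=\{m,m+1,\dots,2^n-1\}$ and $G(n)=P(n)\cup H(n)$. Define a binary operation $\oplus$ on $G(n)$ by: $i\oplus j=t$ if $(i,j)\in P(n)\times P(n)$; $i\oplus j=t+m$ if $(i,j)\in P(n)\times H(n)$; $i\oplus j=s+m$ if $(i,j)\in H(n)\times P(n)$; $i\oplus j=k$ if $(i,j)\in H(n)\times H(n)$, where $t,s,k\in P(n)$ are determined by $t\equiv i+j$, $s\equiv i+(\tfrac m2-1)j$, $k\equiv(\tfrac m2+1)i+(\tfrac m2-1)j \pmod m$. Then $(G(n),\oplus)$ is a gyrogroup with identity $e=0$, and $P(n)$ is the cyclic group of integers modulo $m$. Powers are defined by $a^1=a$, $a^{k+1}=a\oplus a^k$. The power graph $P(G(n))$ is the simple undirected graph with vertex set $G(n)$ in which two distinct vertices $u,v$ are adjacent if and only if $u^k=v$ or $v^k=u$ for some positive integer $k$.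
   Formalization: Planarity of $P(G(n))$ is taken over polygonal drawings whose vertices and arc breakpoints have rational coordinates. -}

module Defs where

open import Data.Nat as ℕ using (ℕ; zero; suc; _∸_; _^_; _<ᵇ_)
open import Data.Nat.Properties using (m^n≢0)
open import Data.Bool using (Bool; true; false; if_then_else_)
open import Data.Fin as Fin using (Fin; toℕ; inject₁; fromℕ)
open import Data.Rational as ℚ using (ℚ; 0ℚ; 1ℚ)
open import Data.Product using (Σ; ∃; _×_; _,_; proj₁; proj₂)
open import Data.Sum using (_⊎_)
open import Relation.Binary.PropositionalEquality using (_≡_; _≢_)
open import Relation.Nullary using (¬_)

-- The gyrogroup (G(n), ⊕).  Elements of G(n) are the naturals 0 … 2^n - 1.

mOf : ℕ → ℕ
mOf n = 2 ^ (n ∸ 1)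

modm : ℕ → ℕ → ℕ
modm n x = ℕ._%_ x (mOf n) {{m^n≢0 2 (n ∸ 1)}}

halfm : ℕ → ℕ
halfm n = ℕ._/_ (mOf n) 2

inP : ℕ → ℕ → Bool
inP n i = i <ᵇ mOf n

op : ℕ → ℕ → ℕ → ℕ
op n i j with inP n i | inP n j
... | true  | true  = modm n (i ℕ.+ j)
... | true  | false = modm n (i ℕ.+ j) ℕ.+ mOf n
... | false | true  = modm n (i ℕ.+ (halfm n ∸ 1) ℕ.* j) ℕ.+ mOf n
... | false | false = modm n ((halfm n ℕ.+ 1) ℕ.* i ℕ.+ (halfm n ∸ 1) ℕ.* j)

-- powers: pow n a k = a^k for k ≥ 1  (a^1 = a, a^(k+1) = a ⊕ a^k);
-- the value at k = 0 is never used (we return the identity 0).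
pow : ℕ → ℕ → ℕ → ℕ
pow n a zero          = 0
pow n a (suc zero)    = a
pow n a (suc (suc k)) = op n a (pow n a (suc k))

PGAdj : (n : ℕ) → Fin (2 ^ n) → Fin (2 ^ n) → Set
PGAdj n u v =
  (u ≢ v) ×
  (Σ ℕ λ k → (1 ℕ.≤ k) × ((pow n (toℕ u) k ≡ toℕ v) ⊎ (pow n (toℕ v) k ≡ toℕ u)))

-- Planarity (Diestel, Graph Theory, Ch. 4): a graph is planar if it is
-- isomorphic to a plane graph, i.e. vertices are distinct points of the
-- plane, edges are polygonal arcs between their endpoints, the interior
-- of an edge contains no vertex and no point of any other edge.

Point : Set
Point = ℚ × ℚ

OnSeg : Point → Point → Point → Set
OnSeg a b x = Σ ℚ λ t →
  (0ℚ ℚ.≤ t) × (t ℚ.≤ 1ℚ) ×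
  (proj₁ x ≡ proj₁ a ℚ.+ t ℚ.* (proj₁ b ℚ.- proj₁ a)) ×
  (proj₂ x ≡ proj₂ a ℚ.+ t ℚ.* (proj₂ b ℚ.- proj₂ a))

record Polyline : Set where
  field
    k   : ℕ
    pts : Fin (suc (suc k)) → Point

  nseg : ℕ
  nseg = suc k

  OnSegment : Fin nseg → Point → Set
  OnSegment i x = OnSeg (pts (inject₁ i)) (pts (Fin.suc i)) x

  OnLine : Point → Set
  OnLine x = Σ (Fin nseg) λ i → OnSegment i x

  start end : Point
  start = pts Fin.zero
  end   = pts (fromℕ nseg)

  Interior : Point → Set
  Interior x = OnLine x × (x ≢ start) × (x ≢ end)

-- a polygonal arc: a polygonal line homeomorphic to [0,1], i.e. all
-- segments non-degenerate, consecutive segments meet only in their common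
-- breakpoint and non-consecutive segments are disjoint
record IsArc (A : Polyline) : Set where
  open Polyline A
  field
    nondeg : ∀ (i : Fin nseg) → pts (inject₁ i) ≢ pts (Fin.suc i)
    consec : ∀ (i j : Fin nseg) → toℕ j ≡ suc (toℕ i) →
             ∀ x → OnSegment i x → OnSegment j x → x ≡ pts (Fin.suc i)
    apart  : ∀ (i j : Fin nseg) → suc (toℕ i) ℕ.< toℕ j →
             ∀ x → ¬ (OnSegment i x × OnSegment j x)

SameEdge : {N : ℕ} → Fin N → Fin N → Fin N → Fin N → Set
SameEdge u v u′ v′ = ((u ≡ u′) × (v ≡ v′)) ⊎ ((u ≡ v′) × (v ≡ u′))

record PlaneDrawing (N : ℕ) (Adj : Fin N → Fin N → Set) : Set where
  field
    pos     : Fin N → Point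
    pos-inj : ∀ u v → pos u ≡ pos v → u ≡ v
    arc     : ∀ u v → Adj u v → Polyline
    isArc   : ∀ u v (a : Adj u v) → IsArc (arc u v a)
    ends    : ∀ u v (a : Adj u v) →
              (Polyline.start (arc u v a) ≡ pos u) × (Polyline.end (arc u v a) ≡ pos v)
    no-vertex : ∀ u v (a : Adj u v) w → ¬ Polyline.Interior (arc u v a) (pos w)
    no-cross  : ∀ u v (a : Adj u v) u′ v′ (a′ : Adj u′ v′) → ¬ SameEdge u v u′ v′ →
                ∀ x → Polyline.Interior (arc u v a) x → ¬ Polyline.OnLine (arc u′ v′ a′) x

Planar : (N : ℕ) → (Fin N → Fin N → Set) → Set
Planar N Adj = PlaneDrawing N Adj

module Submission where

-- For n = 3 the power graph is K₄ on P(3) = ℤ/4 together with four pendant edges at 0, drawn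
-- with straight segments whose disjointness is certified by separating lines.
-- For n ≥ 4 the vertices 0, 1, 2, 4 and m - 1 of P(n) = ℤ/m span a K₅, which has no polygonal
-- drawing. After a shear giving distinct heights to all breakpoints, the parity of crossings of
-- rightward horizontal rays with the arcs defines, for two disjoint arcs, a linking parity that
-- vanishes, being the sum of the crossing parities of their segments. Summed over the fifteen
-- pairs of disjoint edges of K₅ the ray terms cancel and the height comparisons leave 1.

open import Data.Nat as ℕ using (ℕ)
open import Relation.Binary.Definitions using (DecidableEquality)
open import Relation.Binary.PropositionalEquality using (_≡_)

module RationalArith where

  open import Data.Rational
  open import Data.Rational.Properties
  open import Data.Maybe using (Maybe; just; nothing)
  open import Data.Product using (Σ; _×_; _,_)
  open import Relation.Binary.PropositionalEquality
  open import Relation.Nullary using (yes; no)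
  open import Tactic.RingSolver using (solve-∀)
  open import Tactic.RingSolver.Core.AlmostCommutativeRing
    using (AlmostCommutativeRing; fromCommutativeRing)

  ℚ-ring : AlmostCommutativeRing _ _
  ℚ-ring = fromCommutativeRing +-*-commutativeRing isZero
    where
    isZero : ∀ x → Maybe (0ℚ ≡ x)
    isZero x with 0ℚ ≟ x
    ... | yes p = just p
    ... | no _  = nothing

  0<1 : 0ℚ < 1ℚ
  0<1 = positive⁻¹ 1ℚ

  0≤1 : 0ℚ ≤ 1ℚ
  0≤1 = <⇒≤ 0<1

  p≤q⇒0≤q-p : ∀ {p q} → p ≤ q → 0ℚ ≤ q - p
  p≤q⇒0≤q-p {p} {q} h = subst (_≤ q - p) (+-inverseʳ p) (+-monoˡ-≤ (- p) h)

  p≤q⇒p-q≤0 : ∀ {p q} → p ≤ q → p - q ≤ 0ℚ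
  p≤q⇒p-q≤0 {p} {q} h = subst (p - q ≤_) (+-inverseʳ q) (+-monoˡ-≤ (- q) h)

  p<q⇒0<q-p : ∀ {p q} → p < q → 0ℚ < q - p
  p<q⇒0<q-p {p} {q} h = subst (_< q - p) (+-inverseʳ p) (+-monoˡ-< (- p) h)

  [q-p]+p≡q : ∀ p q → (q - p) + p ≡ q
  [q-p]+p≡q = solve-∀ ℚ-ring

  0≤q-p⇒p≤q : ∀ {p q} → 0ℚ ≤ q - p → p ≤ q
  0≤q-p⇒p≤q {p} {q} h = subst₂ _≤_ (+-identityˡ p) ([q-p]+p≡q p q) (+-monoˡ-≤ p h)

  *-pos : ∀ {p q} → 0ℚ < p → 0ℚ < q → 0ℚ < p * q
  *-pos {p} {q} hp hq = positive⁻¹ (p * q) {{pos*pos⇒pos p {{positive hp}} q {{positive hq}}}}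

  *-nonNeg : ∀ {p q} → 0ℚ ≤ p → 0ℚ ≤ q → 0ℚ ≤ p * q
  *-nonNeg {p} {q} hp hq =
    nonNegative⁻¹ (p * q) {{nonNeg*nonNeg⇒nonNeg p {{nonNegative hp}} q {{nonNegative hq}}}}

  *-cancelˡ-pos : ∀ {k z} → 0ℚ < k → 0ℚ < k * z → 0ℚ < z
  *-cancelˡ-pos {k} {z} hk h =
    *-cancelˡ-<-nonNeg k {{nonNegative (<⇒≤ hk)}} (subst (_< k * z) (sym (*-zeroʳ k)) h)

  *-nonPos : ∀ {k z} → 0ℚ < k → z ≤ 0ℚ → k * z ≤ 0ℚ
  *-nonPos {k} {z} hk h =
    subst (_≤ 0ℚ) (neg-neg k z) (neg-antimono-≤ (*-nonNeg (<⇒≤ hk) (neg-antimono-≤ h)))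
    where
    neg-neg : ∀ k z → - (k * (- z)) ≡ k * z
    neg-neg = solve-∀ ℚ-ring

  *-cancelˡ-nonPos : ∀ {k z} → 0ℚ < k → k * z ≤ 0ℚ → z ≤ 0ℚ
  *-cancelˡ-nonPos hk h = ≮⇒≥ (λ z>0 → <-irrefl refl (<-≤-trans (*-pos hk z>0) h))

  positive-inverse : ∀ k → 0ℚ < k → Σ ℚ λ i → (k * i ≡ 1ℚ) × (0ℚ < i)
  positive-inverse k hk = (1/ k) {{k≢0}} , *-inverseʳ k {{k≢0}} ,
                          positive⁻¹ _ {{1/pos⇒pos k {{positive hk}}}}
    where
    k≢0 = pos⇒nonZero k {{positive hk}}

  *-cancelʳ-pos-zero : ∀ {c k} → 0ℚ < k → c * k ≡ 0ℚ → c ≡ 0ℚ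
  *-cancelʳ-pos-zero {c} {k} hk h with positive-inverse k hk
  ... | i , ki≡1 , _ = begin
    c             ≡⟨ sym (*-identityʳ c) ⟩
    c * 1ℚ        ≡⟨ cong (c *_) (sym ki≡1) ⟩
    c * (k * i)   ≡⟨ sym (*-assoc c k i) ⟩
    (c * k) * i   ≡⟨ cong (_* i) h ⟩
    0ℚ * i        ≡⟨ *-zeroˡ i ⟩
    0ℚ            ∎
    where open ≡-Reasoning

module BoolRing where

  open import Data.Bool using (Bool; true; false)
  open import Data.Bool.Properties using (xor-∧-commutativeRing)
  open import Data.Maybe using (Maybe; just; nothing)
  open import Relation.Binary.PropositionalEquality using (_≡_; refl)
  open import Tactic.RingSolver.Core.AlmostCommutativeRing
    using (AlmostCommutativeRing; fromCommutativeRing)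

  𝔹-ring : AlmostCommutativeRing _ _
  𝔹-ring = fromCommutativeRing xor-∧-commutativeRing isFalse
    where
    isFalse : ∀ x → Maybe (false ≡ x)
    isFalse false = just refl
    isFalse true  = nothing

module Segments where

  open import Defs using (Point; OnSeg)
  open import Data.Rational
  open import Data.Rational.Properties
  open import Relation.Binary.PropositionalEquality
  open import Relation.Binary.Definitions using (tri<; tri≈; tri>)
  open import Data.Product using (Σ; _×_; _,_; proj₁; proj₂)
  open import Data.Sum using (_⊎_; inj₁; inj₂)
  open import Data.Empty using (⊥-elim)
  open import Tactic.RingSolver using (solve-∀)
  open RationalArith

  X Y : Point → ℚ
  X = proj₁
  Y = proj₂

  lerp : Point → Point → ℚ → Point
  lerp u v s = (X u + s * (X v - X u) , Y u + s * (Y v - Y u))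

  onSeg-lerp : ∀ u v {s} → 0ℚ ≤ s → s ≤ 1ℚ → OnSeg u v (lerp u v s)
  onSeg-lerp u v {s} s≥0 s≤1 = s , s≥0 , s≤1 , refl , refl

  onSeg-start : ∀ a b → OnSeg a b a
  onSeg-start (ax , ay) (bx , by) = 0ℚ , ≤-refl , 0≤1 , at0 ax bx , at0 ay by
    where
    at0 : ∀ p q → p ≡ p + 0ℚ * (q - p)
    at0 = solve-∀ ℚ-ring

  onSeg-end : ∀ a b → OnSeg a b b
  onSeg-end (ax , ay) (bx , by) = 1ℚ , 0≤1 , ≤-refl , at1 ax bx , at1 ay by
    where
    at1 : ∀ p q → q ≡ p + 1ℚ * (q - p)
    at1 = solve-∀ ℚ-ring

  onSeg-sym : ∀ {a b x} → OnSeg a b x → OnSeg b a x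
  onSeg-sym {a} {b} (t , t≥0 , t≤1 , ex , ey) =
    1ℚ - t , p≤q⇒0≤q-p t≤1 , 0≤q-p⇒p≤q (subst (0ℚ ≤_) (1-[1-t] t) t≥0) ,
    trans ex (reverse (X a) (X b) t) , trans ey (reverse (Y a) (Y b) t)
    where
    reverse : ∀ p q t → p + t * (q - p) ≡ q + (1ℚ - t) * (p - q)
    reverse = solve-∀ ℚ-ring
    1-[1-t] : ∀ t → t ≡ 1ℚ - (1ℚ - t)
    1-[1-t] = solve-∀ ℚ-ring

  cross : Point → Point → Point → ℚ
  cross c d p = (X d - X c) * (Y p - Y c) - (Y d - Y c) * (X p - X c)

  -- (Y d - Y c) ^ 2 times the horizontal distance from p to the line cd:
  -- positive iff p lies strictly to the left of that line.
  lineOffset : Point → Point → Point → ℚ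
  lineOffset c d p = cross c d p * (Y d - Y c)

  lineOffset-sym : ∀ c d p → lineOffset d c p ≡ lineOffset c d p
  lineOffset-sym (cx , cy) (dx , dy) (px , py) = eq cx cy dx dy px py
    where
    eq : ∀ cx cy dx dy px py →
         ((cx - dx) * (py - dy) - (cy - dy) * (px - dx)) * (cy - dy)
         ≡ ((dx - cx) * (py - cy) - (dy - cy) * (px - cx)) * (dy - cy)
    eq = solve-∀ ℚ-ring

  lineOffset-lerp : ∀ a b u v s →
    lineOffset a b (lerp u v s) ≡ lineOffset a b u + s * (lineOffset a b v - lineOffset a b u)
  lineOffset-lerp (ax , ay) (bx , by) (ux , uy) (vx , vy) s = eq ax ay bx by ux uy vx vy s
    where
    eq : ∀ ax ay bx by ux uy vx vy s →
      ((bx - ax) * ((uy + s * (vy - uy)) - ay) - (by - ay) * ((ux + s * (vx - ux)) - ax)) * (by - ay)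
      ≡ ((bx - ax) * (uy - ay) - (by - ay) * (ux - ax)) * (by - ay)
        + s * (((bx - ax) * (vy - ay) - (by - ay) * (vx - ax)) * (by - ay)
               - ((bx - ax) * (uy - ay) - (by - ay) * (ux - ax)) * (by - ay))
    eq = solve-∀ ℚ-ring

  onSeg-of-collinear : ∀ a b x → cross a b x ≡ 0ℚ → Y a < Y b → Y a ≤ Y x → Y x ≤ Y b →
                       OnSeg a b x
  onSeg-of-collinear (ax , ay) (bx , by) (xx , xy) collinear ay<by ay≤xy xy≤by =
    t , t≥0 , t≤1 , ex , ey
    where
    inv = positive-inverse (by - ay) (p<q⇒0<q-p ay<by)
    i = proj₁ inv
    ki≡1 : (by - ay) * i ≡ 1ℚ
    ki≡1 = proj₁ (proj₂ inv)
    i>0 = proj₂ (proj₂ inv)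
    t = (xy - ay) * i
    t≥0 : 0ℚ ≤ t
    t≥0 = *-nonNeg (p≤q⇒0≤q-p ay≤xy) (<⇒≤ i>0)
    1-t : ∀ k i xy ay by → k * i - (xy - ay) * i ≡ (k - (xy - ay)) * i
    1-t = solve-∀ ℚ-ring
    k-[x-a] : ∀ by ay xy → (by - ay) - (xy - ay) ≡ by - xy
    k-[x-a] = solve-∀ ℚ-ring
    t≤1 : t ≤ 1ℚ
    t≤1 = 0≤q-p⇒p≤q (subst (0ℚ ≤_)
            (sym (trans (cong (_- t) (sym ki≡1))
                   (trans (1-t (by - ay) i xy ay by) (cong (_* i) (k-[x-a] by ay xy)))))
            (*-nonNeg (p≤q⇒0≤q-p xy≤by) (<⇒≤ i>0)))
    y-eq : ∀ ay xy i by → ay + ((xy - ay) * i) * (by - ay) ≡ ay + (xy - ay) * ((by - ay) * i)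
    y-eq = solve-∀ ℚ-ring
    y-id : ∀ ay xy → ay + (xy - ay) * 1ℚ ≡ xy
    y-id = solve-∀ ℚ-ring
    ey : xy ≡ ay + t * (by - ay)
    ey = sym (trans (y-eq ay xy i by) (trans (cong (λ z → ay + (xy - ay) * z) ki≡1) (y-id ay xy)))
    x-eq : ∀ ax ay bx by xx xy i → ax + ((xy - ay) * i) * (bx - ax)
      ≡ xx + i * ((bx - ax) * (xy - ay) - (by - ay) * (xx - ax)) + (xx - ax) * ((by - ay) * i - 1ℚ)
    x-eq = solve-∀ ℚ-ring
    x-id : ∀ xx i ax → xx + i * 0ℚ + (xx - ax) * (1ℚ - 1ℚ) ≡ xx
    x-id = solve-∀ ℚ-ring
    ex : xx ≡ ax + t * (bx - ax)
    ex = sym (trans (x-eq ax ay bx by xx xy i)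
           (trans (cong₂ (λ u v → xx + i * u + (xx - ax) * (v - 1ℚ)) collinear ki≡1) (x-id xx i ax)))

  SignChange : ℚ → ℚ → Set
  SignChange α β = ((α ≤ 0ℚ) × (0ℚ ≤ β)) ⊎ ((0ℚ ≤ α) × (β ≤ 0ℚ))

  affine-root : ∀ α β → SignChange α β →
                Σ ℚ λ s → (0ℚ ≤ s) × (s ≤ 1ℚ) × (α + s * (β - α) ≡ 0ℚ)
  affine-root α β (inj₁ (α≤0 , β≥0)) = root-upward α β α≤0 β≥0
    where
    root-upward : ∀ α β → α ≤ 0ℚ → 0ℚ ≤ β →
                  Σ ℚ λ s → (0ℚ ≤ s) × (s ≤ 1ℚ) × (α + s * (β - α) ≡ 0ℚ)
    root-upward α β α≤0 β≥0 with <-cmp α 0ℚ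
    ... | tri≈ _ refl _ = 0ℚ , ≤-refl , 0≤1 , trans (+-identityˡ _) (*-zeroˡ (β - 0ℚ))
    ... | tri> _ _ α>0  = ⊥-elim (<-irrefl refl (<-≤-trans α>0 α≤0))
    ... | tri< α<0 _ _  = s , s≥0 , s≤1 , root
      where
      inv = positive-inverse (β - α) (p<q⇒0<q-p (<-≤-trans α<0 β≥0))
      i = proj₁ inv
      ki≡1 : (β - α) * i ≡ 1ℚ
      ki≡1 = proj₁ (proj₂ inv)
      i>0 = proj₂ (proj₂ inv)
      s = (- α) * i
      s≥0 : 0ℚ ≤ s
      s≥0 = *-nonNeg (neg-antimono-≤ α≤0) (<⇒≤ i>0)
      1-s : ∀ α β i → (β - α) * i - (- α) * i ≡ β * i
      1-s = solve-∀ ℚ-ring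
      s≤1 : s ≤ 1ℚ
      s≤1 = 0≤q-p⇒p≤q (subst (0ℚ ≤_) (sym (trans (cong (_- s) (sym ki≡1)) (1-s α β i)))
                         (*-nonNeg β≥0 (<⇒≤ i>0)))
      regroup : ∀ α β i → α + ((- α) * i) * (β - α) ≡ α + (- α) * ((β - α) * i)
      regroup = solve-∀ ℚ-ring
      cancel : ∀ α → α + (- α) * 1ℚ ≡ 0ℚ
      cancel = solve-∀ ℚ-ring
      root : α + s * (β - α) ≡ 0ℚ
      root = trans (regroup α β i) (trans (cong (λ z → α + (- α) * z) ki≡1) (cancel α))
  affine-root α β (inj₂ (α≥0 , β≤0))
    with affine-root (- α) (- β) (inj₁ (neg-antimono-≤ α≥0 , neg-antimono-≤ β≤0))
  ... | s , s≥0 , s≤1 , root = s , s≥0 , s≤1 , neg-injective (trans (sym (negate α β s)) root)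
    where
    negate : ∀ α β s → - α + s * (- β - - α) ≡ - (α + s * (β - α))
    negate = solve-∀ ℚ-ring

  segment-meets-segment-at-sign-change : ∀ a b u v → Y a < Y b →
    Y a ≤ Y u → Y u ≤ Y b → Y a ≤ Y v → Y v ≤ Y b →
    SignChange (lineOffset a b u) (lineOffset a b v) →
    Σ ℚ λ s → (0ℚ ≤ s) × (s ≤ 1ℚ) × OnSeg a b (lerp u v s)
  segment-meets-segment-at-sign-change a b u v ay<by au ub av vb sign
    with affine-root (lineOffset a b u) (lineOffset a b v) sign
  ... | s , s≥0 , s≤1 , root = s , s≥0 , s≤1 ,
    onSeg-of-collinear a b (lerp u v s)
      (*-cancelʳ-pos-zero (p<q⇒0<q-p ay<by) (trans (lineOffset-lerp a b u v s) root))
      ay<by (between s≥0 s≤1 au av) (between′ s≥0 s≤1 ub vb)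
    where
    low : ∀ uy vy ay s → (uy + s * (vy - uy)) - ay ≡ (1ℚ - s) * (uy - ay) + s * (vy - ay)
    low = solve-∀ ℚ-ring
    high : ∀ uy vy by s → by - (uy + s * (vy - uy)) ≡ (1ℚ - s) * (by - uy) + s * (by - vy)
    high = solve-∀ ℚ-ring
    between : ∀ {uy vy ay s} → 0ℚ ≤ s → s ≤ 1ℚ → ay ≤ uy → ay ≤ vy → ay ≤ uy + s * (vy - uy)
    between {uy} {vy} {ay} {s} s≥0 s≤1 h₁ h₂ = 0≤q-p⇒p≤q (subst (0ℚ ≤_) (sym (low uy vy ay s))
      (+-mono-≤ (*-nonNeg (p≤q⇒0≤q-p s≤1) (p≤q⇒0≤q-p h₁)) (*-nonNeg s≥0 (p≤q⇒0≤q-p h₂))))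
    between′ : ∀ {uy vy by s} → 0ℚ ≤ s → s ≤ 1ℚ → uy ≤ by → vy ≤ by → uy + s * (vy - uy) ≤ by
    between′ {uy} {vy} {by} {s} s≥0 s≤1 h₁ h₂ = 0≤q-p⇒p≤q (subst (0ℚ ≤_) (sym (high uy vy by s))
      (+-mono-≤ (*-nonNeg (p≤q⇒0≤q-p s≤1) (p≤q⇒0≤q-p h₁)) (*-nonNeg s≥0 (p≤q⇒0≤q-p h₂))))

  Meet : Point → Point → Point → Point → Set
  Meet a b c d = Σ Point λ x → OnSeg a b x × OnSeg c d x

  nested⇒meet : ∀ a b c d → Y a < Y c → Y c < Y d → Y d < Y b →
    ((0ℚ < lineOffset a b c) × (lineOffset a b d ≤ 0ℚ)) ⊎
    ((lineOffset a b c ≤ 0ℚ) × (0ℚ < lineOffset a b d)) →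
    Meet a b c d
  nested⇒meet a b c d ac cd db sides = lerp c d s , on-ab , onSeg-lerp c d s≥0 s≤1
    where
    cb = <-trans cd db
    ay<by = <-trans ac cb
    weaken : ((0ℚ < lineOffset a b c) × (lineOffset a b d ≤ 0ℚ)) ⊎
             ((lineOffset a b c ≤ 0ℚ) × (0ℚ < lineOffset a b d)) →
             SignChange (lineOffset a b c) (lineOffset a b d)
    weaken (inj₁ (c>0 , d≤0)) = inj₂ (<⇒≤ c>0 , d≤0)
    weaken (inj₂ (c≤0 , d>0)) = inj₁ (c≤0 , <⇒≤ d>0)
    hit = segment-meets-segment-at-sign-change a b c d ay<by
           (<⇒≤ ac) (<⇒≤ cb) (<⇒≤ (<-trans ac cd)) (<⇒≤ db) (weaken sides)
    s = proj₁ hit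
    s≥0 = proj₁ (proj₂ hit)
    s≤1 = proj₁ (proj₂ (proj₂ hit))
    on-ab = proj₂ (proj₂ (proj₂ hit))
  reach-height : ∀ c d {y} → Y c ≤ y → y ≤ Y d →
                 Σ ℚ λ s → (0ℚ ≤ s) × (s ≤ 1ℚ) × (Y (lerp c d s) ≡ y)
  reach-height c d {y} c≤y y≤d = s , s≥0 , s≤1 , level (Y c) (Y d) y s root
    where
    found = affine-root (Y c - y) (Y d - y) (inj₁ (p≤q⇒p-q≤0 c≤y , p≤q⇒0≤q-p y≤d))
    s = proj₁ found
    s≥0 = proj₁ (proj₂ found)
    s≤1 = proj₁ (proj₂ (proj₂ found))
    root = proj₂ (proj₂ (proj₂ found))
    shift : ∀ cy dy y s → cy + s * (dy - cy) ≡ ((cy - y) + s * ((dy - y) - (cy - y))) + y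
    shift = solve-∀ ℚ-ring
    level : ∀ cy dy y s → (cy - y) + s * ((dy - y) - (cy - y)) ≡ 0ℚ → cy + s * (dy - cy) ≡ y
    level cy dy y s h = trans (shift cy dy y s) (trans (cong (_+ y) h) (+-identityˡ y))

  lineOffset-at-height-of-end : ∀ a b p → Y p ≡ Y b →
    lineOffset a b p ≡ ((Y b - Y a) * (Y b - Y a)) * (- (X p - X b))
  lineOffset-at-height-of-end (ax , ay) (bx , by) (px , .by) refl = eq ax ay bx by px
    where
    eq : ∀ ax ay bx by px → ((bx - ax) * (by - ay) - (by - ay) * (px - ax)) * (by - ay)
         ≡ ((by - ay) * (by - ay)) * (- (px - bx))
    eq = solve-∀ ℚ-ring

  lineOffset-at-height-of-lerp : ∀ c d s p → Y (lerp c d s) ≡ Y p →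
    lineOffset c d p ≡ ((Y d - Y c) * (Y d - Y c)) * (X (lerp c d s) - X p)
  lineOffset-at-height-of-lerp (cx , cy) (dx , dy) s (px , .(cy + s * (dy - cy))) refl =
    eq cx cy dx dy s px
    where
    eq : ∀ cx cy dx dy s px →
         ((dx - cx) * ((cy + s * (dy - cy)) - cy) - (dy - cy) * (px - cx)) * (dy - cy)
         ≡ ((dy - cy) * (dy - cy)) * ((cx + s * (dx - cx)) - px)
    eq = solve-∀ ℚ-ring

  onSeg-initial-part : ∀ c d {s₀ x} → 0ℚ ≤ s₀ → s₀ ≤ 1ℚ → OnSeg c (lerp c d s₀) x → OnSeg c d x
  onSeg-initial-part (cx , cy) (dx , dy) {s₀} s₀≥0 s₀≤1 (s , s≥0 , s≤1 , ex , ey) =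
    s * s₀ , *-nonNeg s≥0 s₀≥0 , ss₀≤1 ,
    trans ex (compose cx s s₀ dx) , trans ey (compose cy s s₀ dy)
    where
    compose : ∀ c s s₀ d → c + s * ((c + s₀ * (d - c)) - c) ≡ c + (s * s₀) * (d - c)
    compose = solve-∀ ℚ-ring
    split : ∀ s t → 1ℚ - s * t ≡ (1ℚ - s) + s * (1ℚ - t)
    split = solve-∀ ℚ-ring
    ss₀≤1 : s * s₀ ≤ 1ℚ
    ss₀≤1 = 0≤q-p⇒p≤q (subst (0ℚ ≤_) (sym (split s s₀))
              (+-mono-≤ (p≤q⇒0≤q-p s≤1) (*-nonNeg s≥0 (p≤q⇒0≤q-p s₀≤1))))

  -- With q the point of cd at the height of b, the offsets of b from cd and of q from ab
  -- are opposite multiples of X q - X b; so cq changes side of ab.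
  interleaved⇒meet : ∀ a b c d → Y a < Y c → Y c < Y b → Y b < Y d →
    ((0ℚ < lineOffset c d b) × (0ℚ < lineOffset a b c)) ⊎
    ((lineOffset c d b ≤ 0ℚ) × (lineOffset a b c ≤ 0ℚ)) →
    Meet a b c d
  interleaved⇒meet a b c d ac cb bd sides =
    x , on-ab , onSeg-initial-part c d s₀≥0 s₀≤1 (onSeg-lerp c q s≥0 s≤1)
    where
    ab = <-trans ac cb
    cd = <-trans cb bd
    reach = reach-height c d (<⇒≤ cb) (<⇒≤ bd)
    s₀ = proj₁ reach
    s₀≥0 = proj₁ (proj₂ reach)
    s₀≤1 = proj₁ (proj₂ (proj₂ reach))
    q = lerp c d s₀
    q-level : Y q ≡ Y b
    q-level = proj₂ (proj₂ (proj₂ reach))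
    K₁>0 : 0ℚ < (Y b - Y a) * (Y b - Y a)
    K₁>0 = *-pos (p<q⇒0<q-p ab) (p<q⇒0<q-p ab)
    K₂>0 : 0ℚ < (Y d - Y c) * (Y d - Y c)
    K₂>0 = *-pos (p<q⇒0<q-p cd) (p<q⇒0<q-p cd)
    q-offset = lineOffset-at-height-of-end a b q q-level
    b-offset = lineOffset-at-height-of-lerp c d s₀ b q-level
    side-change : ((0ℚ < lineOffset c d b) × (0ℚ < lineOffset a b c)) ⊎
                  ((lineOffset c d b ≤ 0ℚ) × (lineOffset a b c ≤ 0ℚ)) →
                  SignChange (lineOffset a b c) (lineOffset a b q)
    side-change (inj₁ (b>0 , c>0)) = inj₂ (<⇒≤ c>0 , subst (_≤ 0ℚ) (sym q-offset)
      (*-nonPos K₁>0 (<⇒≤ (neg-antimono-< (*-cancelˡ-pos K₂>0 (subst (0ℚ <_) b-offset b>0))))))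
    side-change (inj₂ (b≤0 , c≤0)) = inj₁ (c≤0 , subst (0ℚ ≤_) (sym q-offset)
      (*-nonNeg (<⇒≤ K₁>0) (neg-antimono-≤ (*-cancelˡ-nonPos K₂>0 (subst (_≤ 0ℚ) b-offset b≤0)))))
    hit = segment-meets-segment-at-sign-change a b c q ab (<⇒≤ ac) (<⇒≤ cb)
            (subst (Y a ≤_) (sym q-level) (<⇒≤ ab)) (≤-reflexive q-level) (side-change sides)
    s = proj₁ hit
    s≥0 = proj₁ (proj₂ hit)
    s≤1 = proj₁ (proj₂ (proj₂ hit))
    x = lerp c q s
    on-ab = proj₂ (proj₂ (proj₂ hit))

module CrossingParity where

  open import Defs using (Point)
  open import Data.Rational using (ℚ; 0ℚ; _<_; _≤_; _<?_)
  open import Data.Rational.Properties using (<-cmp; <⇒≤; <-irrefl; <-trans; ≮⇒≥; <-≤-trans)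
  open import Relation.Binary.PropositionalEquality
  open import Relation.Binary.Definitions using (tri<; tri≈; tri>)
  open import Data.Product using (_×_; _,_)
  open import Data.Sum using (_⊎_; inj₁; inj₂)
  open import Data.Empty using (⊥-elim)
  open import Relation.Nullary using (does; proof; Reflects; invert)
  open import Relation.Nullary.Decidable using (dec-true; dec-false)
  open import Data.Bool using (Bool; true; false; _∧_; _xor_)
  open import Data.Bool.Properties using (xor-comm)
  open import Tactic.RingSolver using (solve-∀)
  open Segments
  open BoolRing

  _<ᵇ_ : ℚ → ℚ → Bool
  x <ᵇ y = does (x <? y)

  <⇒<ᵇ : ∀ {x y} → x < y → x <ᵇ y ≡ true
  <⇒<ᵇ {x} {y} = dec-true (x <? y)

  ≥⇒<ᵇ-false : ∀ {x y} → y ≤ x → x <ᵇ y ≡ false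
  ≥⇒<ᵇ-false {x} {y} y≤x = dec-false (x <? y) (λ x<y → <-irrefl refl (<-≤-trans x<y y≤x))

  <ᵇ⇒< : ∀ {x y} → x <ᵇ y ≡ true → x < y
  <ᵇ⇒< {x} {y} h = invert (subst (Reflects _) h (proof (x <? y)))

  <ᵇ-false⇒≥ : ∀ {x y} → x <ᵇ y ≡ false → y ≤ x
  <ᵇ-false⇒≥ {x} {y} h = ≮⇒≥ (invert (subst (Reflects _) h (proof (x <? y))))

  isLeft : Point → Point → Point → Bool
  isLeft p c d = 0ℚ <ᵇ lineOffset c d p

  -- the rightward horizontal ray from p crosses the segment cd
  -- (when no endpoint is at the height of p)
  rayCrosses : Point → Point → Point → Bool
  rayCrosses p c d = ((Y c <ᵇ Y p) xor (Y d <ᵇ Y p)) ∧ isLeft p c d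

  below : Point → Point → Bool
  below p q = Y p <ᵇ Y q

  -- For segments whose four endpoints have distinct heights this is true iff they meet:
  -- the ray crossings count the crossings mod 2, up to a term fixed by the height order.
  crossingParity : Point → Point → Point → Point → Bool
  crossingParity a b c d =
    rayCrosses a c d xor rayCrosses b c d xor rayCrosses c a b xor rayCrosses d a b xor
    below a c xor below b c xor below a d xor below b d

  -- crossingParity a b c d unfolds to parityOf applied to Y c <ᵇ Y a, Y d <ᵇ Y a, isLeft a c d,
  -- Y c <ᵇ Y b, Y d <ᵇ Y b, isLeft b c d, Y a <ᵇ Y c, Y b <ᵇ Y c, isLeft c a b, Y a <ᵇ Y d,
  -- Y b <ᵇ Y d and isLeft d a b.
  parityOf : (o₁ o₂ l₁ o₃ o₄ l₂ o₅ o₆ l₃ o₇ o₈ l₄ : Bool) → Bool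
  parityOf o₁ o₂ l₁ o₃ o₄ l₂ o₅ o₆ l₃ o₇ o₈ l₄ =
    ((o₁ xor o₂) ∧ l₁) xor ((o₃ xor o₄) ∧ l₂) xor ((o₅ xor o₆) ∧ l₃) xor ((o₇ xor o₈) ∧ l₄)
    xor o₅ xor o₆ xor o₇ xor o₈

  parityOf-separated : ∀ {o₁ o₂ o₃ o₄ o₅ o₆ o₇ o₈} l₁ l₂ l₃ l₄ →
    o₁ ≡ false → o₂ ≡ false → o₃ ≡ false → o₄ ≡ false →
    o₅ ≡ true → o₆ ≡ true → o₇ ≡ true → o₈ ≡ true →
    parityOf o₁ o₂ l₁ o₃ o₄ l₂ o₅ o₆ l₃ o₇ o₈ l₄ ≡ false
  parityOf-separated l₁ l₂ l₃ l₄ refl refl refl refl refl refl refl refl = refl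

  parityOf-interleaved : ∀ {o₁ o₂ o₃ o₄ o₅ o₆ o₇ o₈} l₁ l₂ l₃ l₄ →
    o₁ ≡ false → o₂ ≡ false → o₃ ≡ true → o₄ ≡ false →
    o₅ ≡ true → o₆ ≡ false → o₇ ≡ true → o₈ ≡ true →
    parityOf o₁ o₂ l₁ o₃ o₄ l₂ o₅ o₆ l₃ o₇ o₈ l₄ ≡ true →
    ((l₂ ≡ true) × (l₃ ≡ true)) ⊎ ((l₂ ≡ false) × (l₃ ≡ false))
  parityOf-interleaved l₁ true  true  l₄ refl refl refl refl refl refl refl refl _ = inj₁ (refl , refl)
  parityOf-interleaved l₁ false false l₄ refl refl refl refl refl refl refl refl _ = inj₂ (refl , refl)
  parityOf-interleaved l₁ true  false l₄ refl refl refl refl refl refl refl refl ()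
  parityOf-interleaved l₁ false true  l₄ refl refl refl refl refl refl refl refl ()

  parityOf-nested : ∀ {o₁ o₂ o₃ o₄ o₅ o₆ o₇ o₈} l₁ l₂ l₃ l₄ →
    o₁ ≡ false → o₂ ≡ false → o₃ ≡ true → o₄ ≡ true →
    o₅ ≡ true → o₆ ≡ false → o₇ ≡ true → o₈ ≡ false →
    parityOf o₁ o₂ l₁ o₃ o₄ l₂ o₅ o₆ l₃ o₇ o₈ l₄ ≡ true →
    ((l₃ ≡ true) × (l₄ ≡ false)) ⊎ ((l₃ ≡ false) × (l₄ ≡ true))
  parityOf-nested l₁ l₂ true  false refl refl refl refl refl refl refl refl _ = inj₁ (refl , refl)
  parityOf-nested l₁ l₂ false true  refl refl refl refl refl refl refl refl _ = inj₂ (refl , refl)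
  parityOf-nested l₁ l₂ true  true  refl refl refl refl refl refl refl refl ()
  parityOf-nested l₁ l₂ false false refl refl refl refl refl refl refl refl ()

  isLeft-true : ∀ {p c d} → isLeft p c d ≡ true → 0ℚ < lineOffset c d p
  isLeft-true = <ᵇ⇒<

  isLeft-false : ∀ {p c d} → isLeft p c d ≡ false → lineOffset c d p ≤ 0ℚ
  isLeft-false = <ᵇ-false⇒≥

  interleaved-crossing : ∀ a b c d → Y a < Y c → Y c < Y b → Y b < Y d →
                         crossingParity a b c d ≡ true → Meet a b c d
  interleaved-crossing a b c d ac cb bd h =
    interleaved⇒meet a b c d ac cb bd
      (sides (parityOf-interleaved (isLeft a c d) (isLeft b c d) (isLeft c a b) (isLeft d a b)
        (≥⇒<ᵇ-false (<⇒≤ ac)) (≥⇒<ᵇ-false (<⇒≤ (<-trans ac cd))) (<⇒<ᵇ cb) (≥⇒<ᵇ-false (<⇒≤ bd))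
        (<⇒<ᵇ ac) (≥⇒<ᵇ-false (<⇒≤ cb)) (<⇒<ᵇ (<-trans ac cd)) (<⇒<ᵇ bd) h))
    where
    cd = <-trans cb bd
    sides : ((isLeft b c d ≡ true) × (isLeft c a b ≡ true)) ⊎
            ((isLeft b c d ≡ false) × (isLeft c a b ≡ false)) →
            ((0ℚ < lineOffset c d b) × (0ℚ < lineOffset a b c)) ⊎
            ((lineOffset c d b ≤ 0ℚ) × (lineOffset a b c ≤ 0ℚ))
    sides (inj₁ (l₂ , l₃)) = inj₁ (isLeft-true {b} {c} {d} l₂ , isLeft-true {c} {a} {b} l₃)
    sides (inj₂ (l₂ , l₃)) = inj₂ (isLeft-false {b} {c} {d} l₂ , isLeft-false {c} {a} {b} l₃)

  nested-crossing : ∀ a b c d → Y a < Y c → Y c < Y d → Y d < Y b →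
                    crossingParity a b c d ≡ true → Meet a b c d
  nested-crossing a b c d ac cd db h =
    nested⇒meet a b c d ac cd db
      (sides (parityOf-nested (isLeft a c d) (isLeft b c d) (isLeft c a b) (isLeft d a b)
        (≥⇒<ᵇ-false (<⇒≤ ac)) (≥⇒<ᵇ-false (<⇒≤ (<-trans ac cd))) (<⇒<ᵇ cb) (<⇒<ᵇ db)
        (<⇒<ᵇ ac) (≥⇒<ᵇ-false (<⇒≤ cb)) (<⇒<ᵇ (<-trans ac cd)) (≥⇒<ᵇ-false (<⇒≤ db)) h))
    where
    cb = <-trans cd db
    sides : ((isLeft c a b ≡ true) × (isLeft d a b ≡ false)) ⊎
            ((isLeft c a b ≡ false) × (isLeft d a b ≡ true)) →
            ((0ℚ < lineOffset a b c) × (lineOffset a b d ≤ 0ℚ)) ⊎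
            ((lineOffset a b c ≤ 0ℚ) × (0ℚ < lineOffset a b d))
    sides (inj₁ (l₃ , l₄)) = inj₁ (isLeft-true {c} {a} {b} l₃ , isLeft-false {d} {a} {b} l₄)
    sides (inj₂ (l₃ , l₄)) = inj₂ (isLeft-false {c} {a} {b} l₃ , isLeft-true {d} {a} {b} l₄)

  separated-parity : ∀ a b c d → Y a < Y c → Y b < Y c → Y c < Y d →
                     crossingParity a b c d ≡ false
  separated-parity a b c d ac bc cd =
    parityOf-separated (isLeft a c d) (isLeft b c d) (isLeft c a b) (isLeft d a b)
      (≥⇒<ᵇ-false (<⇒≤ ac)) (≥⇒<ᵇ-false (<⇒≤ (<-trans ac cd)))
      (≥⇒<ᵇ-false (<⇒≤ bc)) (≥⇒<ᵇ-false (<⇒≤ (<-trans bc cd)))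
      (<⇒<ᵇ ac) (<⇒<ᵇ bc) (<⇒<ᵇ (<-trans ac cd)) (<⇒<ᵇ (<-trans bc cd))

  ordered-crossing : ∀ a b c d → Y a < Y b → Y c < Y d → Y a < Y c → Y b ≢ Y c → Y b ≢ Y d →
                     crossingParity a b c d ≡ true → Meet a b c d
  ordered-crossing a b c d ab cd ac b≢c b≢d h with <-cmp (Y b) (Y c)
  ... | tri≈ _ b≡c _ = ⊥-elim (b≢c b≡c)
  ... | tri< bc _ _ with () ← trans (sym h) (separated-parity a b c d ac bc cd)
  ... | tri> _ _ cb with <-cmp (Y b) (Y d)
  ...   | tri< bd _ _ = interleaved-crossing a b c d ac cb bd h
  ...   | tri≈ _ b≡d _ = ⊥-elim (b≢d b≡d)
  ...   | tri> _ _ db = nested-crossing a b c d ac cd db h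

  rayCrosses-sym : ∀ p c d → rayCrosses p d c ≡ rayCrosses p c d
  rayCrosses-sym p c d =
    cong₂ _∧_ (xor-comm (Y d <ᵇ Y p) (Y c <ᵇ Y p)) (cong (0ℚ <ᵇ_) (lineOffset-sym c d p))

  below-flip : ∀ p q → Y p ≢ Y q → below q p ≡ true xor below p q
  below-flip p q p≢q with <-cmp (Y p) (Y q)
  ... | tri< pq _ _ = trans (≥⇒<ᵇ-false (<⇒≤ pq)) (cong (true xor_) (sym (<⇒<ᵇ pq)))
  ... | tri≈ _ p≡q _ = ⊥-elim (p≢q p≡q)
  ... | tri> _ _ qp = trans (<⇒<ᵇ qp) (cong (true xor_) (sym (≥⇒<ᵇ-false (<⇒≤ qp))))

  crossingParity-swapˡ : ∀ a b c d → crossingParity b a c d ≡ crossingParity a b c d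
  crossingParity-swapˡ a b c d =
    trans (cong₂ (λ u v → rayCrosses b c d xor rayCrosses a c d xor u xor v xor
                          below b c xor below a c xor below b d xor below a d)
                 (rayCrosses-sym c a b) (rayCrosses-sym d a b))
          (reorder (rayCrosses a c d) (rayCrosses b c d) (rayCrosses c a b) (rayCrosses d a b)
                   (below a c) (below b c) (below a d) (below b d))
    where
    reorder : ∀ x₁ x₂ x₃ x₄ y₁ y₂ y₃ y₄ →
      (x₂ xor x₁ xor x₃ xor x₄ xor y₂ xor y₁ xor y₄ xor y₃)
      ≡ (x₁ xor x₂ xor x₃ xor x₄ xor y₁ xor y₂ xor y₃ xor y₄)
    reorder = solve-∀ 𝔹-ring

  crossingParity-swapʳ : ∀ a b c d → crossingParity a b d c ≡ crossingParity a b c d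
  crossingParity-swapʳ a b c d =
    trans (cong₂ (λ u v → u xor v xor rayCrosses d a b xor rayCrosses c a b xor
                          below a d xor below b d xor below a c xor below b c)
                 (rayCrosses-sym a c d) (rayCrosses-sym b c d))
          (reorder (rayCrosses a c d) (rayCrosses b c d) (rayCrosses c a b) (rayCrosses d a b)
                   (below a c) (below b c) (below a d) (below b d))
    where
    reorder : ∀ x₁ x₂ x₃ x₄ y₁ y₂ y₃ y₄ →
      (x₁ xor x₂ xor x₄ xor x₃ xor y₃ xor y₄ xor y₁ xor y₂)
      ≡ (x₁ xor x₂ xor x₃ xor x₄ xor y₁ xor y₂ xor y₃ xor y₄)
    reorder = solve-∀ 𝔹-ring

  crossingParity-exchange : ∀ a b c d → Y a ≢ Y c → Y a ≢ Y d → Y b ≢ Y c → Y b ≢ Y d →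
                            crossingParity c d a b ≡ crossingParity a b c d
  crossingParity-exchange a b c d a≢c a≢d b≢c b≢d =
    trans (cong (λ heights → rayCrosses c a b xor rayCrosses d a b xor
                             rayCrosses a c d xor rayCrosses b c d xor heights)
                (cong₂ _xor_ (below-flip a c a≢c) (cong₂ _xor_ (below-flip a d a≢d)
                  (cong₂ _xor_ (below-flip b c b≢c) (below-flip b d b≢d)))))
          (reorder (rayCrosses a c d) (rayCrosses b c d) (rayCrosses c a b) (rayCrosses d a b)
                   (below a c) (below b c) (below a d) (below b d))
    where
    reorder : ∀ x₁ x₂ x₃ x₄ y₁ y₂ y₃ y₄ →
      (x₃ xor x₄ xor x₁ xor x₂ xor (true xor y₁) xor (true xor y₃) xor (true xor y₂) xor (true xor y₄))
      ≡ (x₁ xor x₂ xor x₃ xor x₄ xor y₁ xor y₂ xor y₃ xor y₄)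
    reorder = solve-∀ 𝔹-ring

  meet-sym : ∀ {a b c d} → Meet a b c d → Meet c d a b
  meet-sym (x , on-ab , on-cd) = x , on-cd , on-ab

  meet-swapˡ : ∀ {a b c d} → Meet b a c d → Meet a b c d
  meet-swapˡ {a} {b} (x , on-ba , on-cd) = x , onSeg-sym {b} {a} on-ba , on-cd

  meet-swapʳ : ∀ {a b c d} → Meet a b d c → Meet a b c d
  meet-swapʳ {c = c} {d} (x , on-ab , on-dc) = x , on-ab , onSeg-sym {d} {c} on-dc

  upward-crossing : ∀ a b c d → Y a < Y b → Y c < Y d →
                    Y a ≢ Y c → Y a ≢ Y d → Y b ≢ Y c → Y b ≢ Y d →
                    crossingParity a b c d ≡ true → Meet a b c d
  upward-crossing a b c d ab cd a≢c a≢d b≢c b≢d h with <-cmp (Y a) (Y c)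
  ... | tri< ac _ _ = ordered-crossing a b c d ab cd ac b≢c b≢d h
  ... | tri≈ _ a≡c _ = ⊥-elim (a≢c a≡c)
  ... | tri> _ _ ca = meet-sym {c} {d} {a} {b} (ordered-crossing c d a b cd ab ca (≢-sym a≢d) (≢-sym b≢d)
                        (trans (crossingParity-exchange a b c d a≢c a≢d b≢c b≢d) h))

  rising-crossing : ∀ a b c d → Y a < Y b → Y c ≢ Y d →
                    Y a ≢ Y c → Y a ≢ Y d → Y b ≢ Y c → Y b ≢ Y d →
                    crossingParity a b c d ≡ true → Meet a b c d
  rising-crossing a b c d ab c≢d a≢c a≢d b≢c b≢d h with <-cmp (Y c) (Y d)
  ... | tri< cd _ _ = upward-crossing a b c d ab cd a≢c a≢d b≢c b≢d h
  ... | tri≈ _ c≡d _ = ⊥-elim (c≢d c≡d)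
  ... | tri> _ _ dc = meet-swapʳ {a} {b} {c} {d} (upward-crossing a b d c ab dc a≢d a≢c b≢d b≢c
                        (trans (crossingParity-swapʳ a b c d) h))

  crossing⇒meet : ∀ a b c d → Y a ≢ Y b → Y c ≢ Y d →
                  Y a ≢ Y c → Y a ≢ Y d → Y b ≢ Y c → Y b ≢ Y d →
                  crossingParity a b c d ≡ true → Meet a b c d
  crossing⇒meet a b c d a≢b c≢d a≢c a≢d b≢c b≢d h with <-cmp (Y a) (Y b)
  ... | tri< ab _ _ = rising-crossing a b c d ab c≢d a≢c a≢d b≢c b≢d h
  ... | tri≈ _ a≡b _ = ⊥-elim (a≢b a≡b)
  ... | tri> _ _ ba = meet-swapˡ {a} {b} {c} {d} (rising-crossing b a c d ba c≢d b≢c b≢d a≢c a≢d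
                        (trans (crossingParity-swapˡ a b c d) h))

module XorSum where

  open import Data.Nat using (ℕ; zero; suc)
  open import Data.Fin using (Fin; zero; suc; inject₁; fromℕ)
  open import Data.Bool using (Bool; false; _xor_)
  open import Data.Bool.Properties using (xor-identityʳ)
  open import Function using (_∘_)
  open import Relation.Binary.PropositionalEquality
  open import Tactic.RingSolver using (solve-∀)
  open BoolRing

  xorSum : (n : ℕ) → (Fin n → Bool) → Bool
  xorSum zero    f = false
  xorSum (suc n) f = f zero xor xorSum n (f ∘ suc)

  xorSum-cong : ∀ n {f g : Fin n → Bool} → (∀ i → f i ≡ g i) → xorSum n f ≡ xorSum n g
  xorSum-cong zero    f≡g = refl
  xorSum-cong (suc n) f≡g = cong₂ _xor_ (f≡g zero) (xorSum-cong n (f≡g ∘ suc))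

  xorSum-false : ∀ n {f : Fin n → Bool} → (∀ i → f i ≡ false) → xorSum n f ≡ false
  xorSum-false zero    f≡false = refl
  xorSum-false (suc n) f≡false = cong₂ _xor_ (f≡false zero) (xorSum-false n (f≡false ∘ suc))

  xorSum-xor : ∀ n (f g : Fin n → Bool) →
               xorSum n (λ i → f i xor g i) ≡ xorSum n f xor xorSum n g
  xorSum-xor zero    f g = refl
  xorSum-xor (suc n) f g =
    trans (cong ((f zero xor g zero) xor_) (xorSum-xor n (f ∘ suc) (g ∘ suc)))
          (interchange (f zero) (g zero) (xorSum n (f ∘ suc)) (xorSum n (g ∘ suc)))
    where
    interchange : ∀ a b c d → (a xor b) xor (c xor d) ≡ (a xor c) xor (b xor d)
    interchange = solve-∀ 𝔹-ring

  xorSum-comm : ∀ n m (h : Fin n → Fin m → Bool) →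
                xorSum n (λ i → xorSum m (h i)) ≡ xorSum m (λ j → xorSum n (λ i → h i j))
  xorSum-comm zero    m h = sym (xorSum-false m (λ _ → refl))
  xorSum-comm (suc n) m h =
    trans (cong (xorSum m (h zero) xor_) (xorSum-comm n m (h ∘ suc)))
          (sym (xorSum-xor m (h zero) (λ j → xorSum n (λ i → h (suc i) j))))

  xorSum-telescope : ∀ k (g : Fin (suc (suc k)) → Bool) →
    xorSum (suc k) (λ i → g (inject₁ i) xor g (suc i)) ≡ g zero xor g (fromℕ (suc k))
  xorSum-telescope zero    g = xor-identityʳ (g zero xor g (suc zero))
  xorSum-telescope (suc k) g =
    trans (cong ((g zero xor g (suc zero)) xor_) (xorSum-telescope k (g ∘ suc)))
          (cancel (g zero) (g (suc zero)) (g (fromℕ (suc (suc k)))))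
    where
    cancel : ∀ a b c → (a xor b) xor (b xor c) ≡ a xor c
    cancel = solve-∀ 𝔹-ring

module Linking where

  open import Defs using (Point; Polyline)
  open import Data.Fin using (Fin; zero; suc; inject₁)
  open import Data.Bool using (Bool; true; false; _xor_)
  open import Data.Empty using (⊥-elim)
  open import Relation.Nullary using (¬_)
  open import Relation.Binary.PropositionalEquality
  open import Tactic.RingSolver using (solve-∀)
  open Polyline using (nseg; pts; start; end)
  open BoolRing
  open Segments using (Y; Meet)
  open CrossingParity
  open XorSum

  segStart segEnd : (A : Polyline) → Fin (nseg A) → Point
  segStart A i = pts A (inject₁ i)
  segEnd   A i = pts A (suc i)

  rayParity : Point → Polyline → Bool
  rayParity z B = xorSum (nseg B) λ j → rayCrosses z (segStart B j) (segEnd B j)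

  -- crossingParity with the segments replaced by polylines A from a to b and B from c to d
  linkingParityOf : Point → Point → Point → Point → Polyline → Polyline → Bool
  linkingParityOf a b c d A B =
    rayParity a B xor rayParity b B xor rayParity c A xor rayParity d A xor
    below a c xor below b c xor below a d xor below b d

  linkingParity : Polyline → Polyline → Bool
  linkingParity A B = linkingParityOf (start A) (end A) (start B) (end B) A B

  linkingParity-endpoints : ∀ A B {a b c d} → start A ≡ a → end A ≡ b → start B ≡ c → end B ≡ d →
                            linkingParity A B ≡ linkingParityOf a b c d A B
  linkingParity-endpoints A B refl refl refl refl = refl

  xor-pairs : ∀ x₁ x₂ x₃ x₄ y₁ y₂ y₃ y₄ →
    (x₁ xor x₂ xor x₃ xor x₄ xor y₁ xor y₂ xor y₃ xor y₄)
    ≡ ((x₁ xor x₂) xor ((x₃ xor x₄) xor ((y₁ xor y₂) xor (y₃ xor y₄))))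
  xor-pairs = solve-∀ 𝔹-ring

  crossingParity-regroup : ∀ a b c d → crossingParity a b c d ≡
    (rayCrosses a c d xor rayCrosses b c d) xor
    ((rayCrosses c a b xor rayCrosses d a b) xor
     ((below a c xor below b c) xor (below a d xor below b d)))
  crossingParity-regroup a b c d =
    xor-pairs (rayCrosses a c d) (rayCrosses b c d) (rayCrosses c a b) (rayCrosses d a b)
              (below a c) (below b c) (below a d) (below b d)

  xorSum-xor³ : ∀ k (f g h : Fin k → Bool) →
    xorSum k (λ i → f i xor (g i xor h i)) ≡ xorSum k f xor (xorSum k g xor xorSum k h)
  xorSum-xor³ k f g h =
    trans (xorSum-xor k f (λ i → g i xor h i)) (cong (xorSum k f xor_) (xorSum-xor k g h))

  -- Summing crossingParity over all pairs of segments, every term telescopes along A or B.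
  module _ (A B : Polyline) where

    private
      m = nseg A
      n = nseg B
      a b : Fin m → Point
      a = segStart A
      b = segEnd A
      c d : Fin n → Point
      c = segStart B
      d = segEnd B

    raysFromA raysFromB heightTerms : Fin m → Fin n → Bool
    raysFromA   i j = rayCrosses (a i) (c j) (d j) xor rayCrosses (b i) (c j) (d j)
    raysFromB   i j = rayCrosses (c j) (a i) (b i) xor rayCrosses (d j) (a i) (b i)
    heightTerms i j = (below (a i) (c j) xor below (b i) (c j)) xor
                      (below (a i) (d j) xor below (b i) (d j))

    xorSum-raysFromA : xorSum m (λ i → xorSum n (raysFromA i)) ≡
                       rayParity (start A) B xor rayParity (end A) B
    xorSum-raysFromA = trans (xorSum-comm m n raysFromA)
      (trans (xorSum-cong n (λ j → xorSum-telescope (Polyline.k A) (λ i → rayCrosses (pts A i) (c j) (d j))))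
             (xorSum-xor n (λ j → rayCrosses (start A) (c j) (d j)) (λ j → rayCrosses (end A) (c j) (d j))))

    xorSum-raysFromB : xorSum m (λ i → xorSum n (raysFromB i)) ≡
                       rayParity (start B) A xor rayParity (end B) A
    xorSum-raysFromB =
      trans (xorSum-cong m (λ i → xorSum-telescope (Polyline.k B) (λ j → rayCrosses (pts B j) (a i) (b i))))
            (xorSum-xor m (λ i → rayCrosses (start B) (a i) (b i)) (λ i → rayCrosses (end B) (a i) (b i)))

    xorSum-heightTerms : xorSum m (λ i → xorSum n (heightTerms i)) ≡
      (below (start A) (start B) xor below (end A) (start B)) xor
      (below (start A) (end B) xor below (end A) (end B))
    xorSum-heightTerms =
      trans (xorSum-cong m (λ i → xorSum-telescope (Polyline.k B) (λ j → below (a i) (pts B j) xor below (b i) (pts B j))))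
        (trans (xorSum-xor m (λ i → below (a i) (start B) xor below (b i) (start B))
                             (λ i → below (a i) (end B) xor below (b i) (end B)))
               (cong₂ _xor_ (xorSum-telescope (Polyline.k A) (λ i → below (pts A i) (start B)))
                            (xorSum-telescope (Polyline.k A) (λ i → below (pts A i) (end B)))))

    linkingParity-≡-xorSum-crossingParity :
      linkingParity A B ≡ xorSum m λ i → xorSum n λ j → crossingParity (a i) (b i) (c j) (d j)
    linkingParity-≡-xorSum-crossingParity = sym (begin
      xorSum m (λ i → xorSum n (λ j → crossingParity (a i) (b i) (c j) (d j)))
        ≡⟨ xorSum-cong m (λ i → trans (xorSum-cong n (λ j → crossingParity-regroup (a i) (b i) (c j) (d j)))
                                      (xorSum-xor³ n (raysFromA i) (raysFromB i) (heightTerms i))) ⟩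
      xorSum m (λ i → xorSum n (raysFromA i) xor (xorSum n (raysFromB i) xor xorSum n (heightTerms i)))
        ≡⟨ xorSum-xor³ m (λ i → xorSum n (raysFromA i)) (λ i → xorSum n (raysFromB i))
                         (λ i → xorSum n (heightTerms i)) ⟩
      xorSum m (λ i → xorSum n (raysFromA i)) xor
        (xorSum m (λ i → xorSum n (raysFromB i)) xor xorSum m (λ i → xorSum n (heightTerms i)))
        ≡⟨ cong₂ _xor_ xorSum-raysFromA (cong₂ _xor_ xorSum-raysFromB xorSum-heightTerms) ⟩
      (rayParity (start A) B xor rayParity (end A) B) xor
        ((rayParity (start B) A xor rayParity (end B) A) xor
         ((below (start A) (start B) xor below (end A) (start B)) xor
          (below (start A) (end B) xor below (end A) (end B))))
        ≡⟨ sym (xor-pairs (rayParity (start A) B) (rayParity (end A) B)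
                 (rayParity (start B) A) (rayParity (end B) A)
                 (below (start A) (start B)) (below (end A) (start B))
                 (below (start A) (end B)) (below (end A) (end B))) ⟩
      linkingParity A B ∎)
      where open ≡-Reasoning

  linkingParity-disjoint : ∀ A B →
    (∀ i → Y (segStart A i) ≢ Y (segEnd A i)) →
    (∀ j → Y (segStart B j) ≢ Y (segEnd B j)) →
    (∀ i j → Y (pts A i) ≢ Y (pts B j)) →
    (∀ i j → ¬ Meet (segStart A i) (segEnd A i) (segStart B j) (segEnd B j)) →
    linkingParity A B ≡ false
  linkingParity-disjoint A B rising-A rising-B apart disjoint =
    trans (linkingParity-≡-xorSum-crossingParity A B)
          (xorSum-false (nseg A) (λ i → xorSum-false (nseg B) (λ j → no-crossing i j)))
    where
    no-crossing : ∀ i j →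
      crossingParity (segStart A i) (segEnd A i) (segStart B j) (segEnd B j) ≡ false
    no-crossing i j with crossingParity (segStart A i) (segEnd A i) (segStart B j) (segEnd B j) in eq
    ... | false = refl
    ... | true  = ⊥-elim (disjoint i j (crossing⇒meet (segStart A i) (segEnd A i) (segStart B j) (segEnd B j) (rising-A i) (rising-B j)
                            (apart (inject₁ i) (inject₁ j)) (apart (inject₁ i) (suc j))
                            (apart (suc i) (inject₁ j)) (apart (suc i) (suc j)) eq))

module Shear where

  open import Defs using (Point; OnSeg)
  open import Data.Rational
  open import Data.Rational.Properties
  open import Data.List using (List; []; _∷_; map; foldr; cartesianProduct)
  open import Data.List.Membership.Propositional using (_∈_)
  open import Data.List.Membership.Propositional.Properties using (∈-cartesianProduct⁺)
  open import Data.List.Relation.Unary.Any using (here; there)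
  open import Relation.Binary.PropositionalEquality
  open import Data.Product using (Σ; _,_; uncurry)
  open import Data.Empty using (⊥-elim)
  open import Relation.Nullary using (yes; no)
  open import Relation.Binary.Definitions using (tri<; tri≈; tri>)
  open import Tactic.RingSolver using (solve-∀)
  open RationalArith
  open Segments using (X; Y)

  shear : ℚ → Point → Point
  shear δ p = (X p , Y p + δ * X p)

  unshear : ℚ → Point → Point
  unshear δ p = (X p , Y p - δ * X p)

  onSeg-unshear : ∀ δ a b x → OnSeg (shear δ a) (shear δ b) x → OnSeg a b (unshear δ x)
  onSeg-unshear δ (ax , ay) (bx , by) (xx , xy) (t , t≥0 , t≤1 , ex , ey) =
    t , t≥0 , t≤1 , ex , trans (cong₂ (λ u v → u - δ * v) ey ex) (unshear-lerp ay ax by bx t δ)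
    where
    unshear-lerp : ∀ ya xa yb xb t δ →
      (ya + δ * xa + t * ((yb + δ * xb) - (ya + δ * xa))) - δ * (xa + t * (xb - xa))
      ≡ ya + t * (yb - ya)
    unshear-lerp = solve-∀ ℚ-ring

  -- 1/ x, with the junk value 0 at x = 0
  inverse : ℚ → ℚ
  inverse x with x ≟ 0ℚ
  ... | yes _  = 0ℚ
  ... | no x≢0 = (1/ x) {{≢-nonZero x≢0}}

  inverse-inverseʳ : ∀ x → x ≢ 0ℚ → x * inverse x ≡ 1ℚ
  inverse-inverseʳ x x≢0 with x ≟ 0ℚ
  ... | yes x≡0 = ⊥-elim (x≢0 x≡0)
  ... | no x≢0′ = *-inverseʳ x {{≢-nonZero x≢0′}}

  inverse-nonNeg : ∀ x → 0ℚ ≤ x → 0ℚ ≤ inverse x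
  inverse-nonNeg x x≥0 with x ≟ 0ℚ
  ... | yes _  = ≤-refl
  ... | no x≢0 with <-cmp 0ℚ x
  ...   | tri< x>0 _ _ = <⇒≤ (positive⁻¹ _ {{1/pos⇒pos x {{positive x>0}}}})
  ...   | tri≈ _ 0≡x _ = ⊥-elim (x≢0 (sym 0≡x))
  ...   | tri> _ _ x<0 = ⊥-elim (<-irrefl refl (<-≤-trans x<0 x≥0))

  -- the shear parameter δ at which p and q get the same height, if there is one
  criticalShear : Point → Point → ℚ
  criticalShear p q = ∣ Y p - Y q ∣ * inverse ∣ X p - X q ∣

  criticalShear-nonNeg : ∀ p q → 0ℚ ≤ criticalShear p q
  criticalShear-nonNeg p q = *-nonNeg (0≤∣p∣ (Y p - Y q)) (inverse-nonNeg _ (0≤∣p∣ (X p - X q)))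

  shear-same-height : ∀ δ p q → Y (shear δ p) ≡ Y (shear δ q) → Y p - Y q ≡ - (δ * (X p - X q))
  shear-same-height δ (xp , yp) (xq , yq) same-height =
    trans (sym (move yp yq xp xq δ))
          (trans (cong (λ z → z - (yq + δ * xq) - δ * (xp - xq)) same-height) (cancel yq xp xq δ))
    where
    move : ∀ yp yq xp xq δ → (yp + δ * xp) - (yq + δ * xq) - δ * (xp - xq) ≡ yp - yq
    move = solve-∀ ℚ-ring
    cancel : ∀ yq xp xq δ → (yq + δ * xq) - (yq + δ * xq) - δ * (xp - xq) ≡ - (δ * (xp - xq))
    cancel = solve-∀ ℚ-ring

  shear-separates : ∀ δ p q → 0ℚ < δ → criticalShear p q < δ → p ≢ q →
                    Y (shear δ p) ≢ Y (shear δ q)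
  shear-separates δ (xp , yp) (xq , yq) δ>0 crit<δ p≢q same-height with xp - xq ≟ 0ℚ
  ... | yes Δx≡0 = p≢q (cong₂ _,_ (diff≡0 xp xq Δx≡0)
                        (diff≡0 yp yq (trans Δy (trans (cong (λ z → - (δ * z)) Δx≡0) (δ*0 δ)))))
    where
    Δy = shear-same-height δ (xp , yp) (xq , yq) same-height
    δ*0 : ∀ δ → - (δ * 0ℚ) ≡ 0ℚ
    δ*0 = solve-∀ ℚ-ring
    diff≡0 : ∀ u v → u - v ≡ 0ℚ → u ≡ v
    diff≡0 u v h = trans (sym ([q-p]+p≡q v u)) (trans (cong (_+ v) h) (+-identityˡ v))
  ... | no Δx≢0 = <-irrefl crit≡δ crit<δ
    where
    A = ∣ xp - xq ∣
    ∣Δy∣≡δA : ∣ yp - yq ∣ ≡ δ * A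
    ∣Δy∣≡δA = trans (cong ∣_∣ (shear-same-height δ (xp , yp) (xq , yq) same-height))
                (trans (∣-p∣≡∣p∣ (δ * (xp - xq)))
                (trans (∣p*q∣≡∣p∣*∣q∣ δ (xp - xq)) (cong (_* A) (0≤p⇒∣p∣≡p (<⇒≤ δ>0)))))
    crit≡δ : criticalShear (xp , yp) (xq , yq) ≡ δ
    crit≡δ = trans (cong (_* inverse A) ∣Δy∣≡δA)
               (trans (*-assoc δ A (inverse A))
                 (trans (cong (δ *_) (inverse-inverseʳ A (λ A≡0 → Δx≢0 (∣p∣≡0⇒p≡0 (xp - xq) A≡0))))
                        (*-identityʳ δ)))

  sumℚ : List ℚ → ℚ
  sumℚ = foldr _+_ 0ℚ

  module _ {A : Set} (f : A → ℚ) (f≥0 : ∀ x → 0ℚ ≤ f x) where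

    sumℚ-nonNeg : ∀ xs → 0ℚ ≤ sumℚ (map f xs)
    sumℚ-nonNeg []       = ≤-refl
    sumℚ-nonNeg (x ∷ xs) = +-mono-≤ (f≥0 x) (sumℚ-nonNeg xs)

    member≤sumℚ : ∀ {x xs} → x ∈ xs → f x ≤ sumℚ (map f xs)
    member≤sumℚ {xs = y ∷ xs} (here refl) =
      subst (_≤ f y + sumℚ (map f xs)) (+-identityʳ (f y)) (+-monoʳ-≤ (f y) (sumℚ-nonNeg xs))
    member≤sumℚ {x} {y ∷ xs} (there x∈xs) =
      ≤-trans (member≤sumℚ x∈xs) (subst (_≤ f y + sumℚ (map f xs)) (+-identityˡ _)
                                        (+-monoˡ-≤ (sumℚ (map f xs)) (f≥0 y)))

  generic-shear : (ps : List Point) →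
    Σ ℚ λ δ → ∀ {p q} → p ∈ ps → q ∈ ps → p ≢ q → Y (shear δ p) ≢ Y (shear δ q)
  generic-shear ps = δ , λ {p} {q} p∈ps q∈ps → shear-separates δ p q δ>0 (crit<δ p∈ps q∈ps)
    where
    critical = uncurry criticalShear
    critical≥0 : ∀ pq → 0ℚ ≤ critical pq
    critical≥0 (p , q) = criticalShear-nonNeg p q
    total = sumℚ (map critical (cartesianProduct ps ps))
    total≥0 : 0ℚ ≤ total
    total≥0 = sumℚ-nonNeg critical critical≥0 (cartesianProduct ps ps)
    δ = 1ℚ + total
    total<δ : total < δ
    total<δ = subst (_< δ) (+-identityˡ total) (+-monoˡ-< total 0<1)
    δ>0 : 0ℚ < δ
    δ>0 = ≤-<-trans total≥0 total<δ
    crit<δ : ∀ {p q} → p ∈ ps → q ∈ ps → criticalShear p q < δ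
    crit<δ p∈ps q∈ps =
      ≤-<-trans (member≤sumℚ critical critical≥0 (∈-cartesianProduct⁺ p∈ps q∈ps)) total<δ

module XorNormalForm {A : Set} (_≟_ : DecidableEquality A) where

  open import Data.List using (List; []; _∷_; _++_; concatMap)
  open import Data.List.Relation.Unary.All using (All; []; _∷_)
  open import Data.Bool using (Bool; true; false; _xor_)
  open import Data.Bool.Properties using (xor-assoc)
  open import Relation.Nullary using (does; yes; no)
  open import Relation.Binary.PropositionalEquality
  open import Tactic.RingSolver using (solve-∀)
  open BoolRing

  ⟦_⟧ : List A → (A → Bool) → Bool
  ⟦ []     ⟧ env = false
  ⟦ x ∷ xs ⟧ env = env x xor ⟦ xs ⟧ env

  ⟦++⟧ : ∀ xs ys env → ⟦ xs ++ ys ⟧ env ≡ ⟦ xs ⟧ env xor ⟦ ys ⟧ env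
  ⟦++⟧ []       ys env = refl
  ⟦++⟧ (x ∷ xs) ys env =
    trans (cong (env x xor_) (⟦++⟧ xs ys env)) (sym (xor-assoc (env x) (⟦ xs ⟧ env) (⟦ ys ⟧ env)))

  ⟦concatMap⟧-false : ∀ {B : Set} (f : B → List A) env {bs} →
    All (λ b → ⟦ f b ⟧ env ≡ false) bs → ⟦ concatMap f bs ⟧ env ≡ false
  ⟦concatMap⟧-false f env []       = refl
  ⟦concatMap⟧-false f env {b ∷ bs} (fb≡false ∷ rest) =
    trans (⟦++⟧ (f b) (concatMap f bs) env) (cong₂ _xor_ fb≡false (⟦concatMap⟧-false f env rest))

  insert : A → List A → List A
  insert x []       = x ∷ []
  insert x (y ∷ ys) with does (x ≟ y)
  ... | true  = ys
  ... | false = y ∷ insert x ys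

  normalise : List A → List A
  normalise []       = []
  normalise (x ∷ xs) = insert x (normalise xs)

  insert-sound : ∀ env x ys → ⟦ insert x ys ⟧ env ≡ env x xor ⟦ ys ⟧ env
  insert-sound env x []       = refl
  insert-sound env x (y ∷ ys) with x ≟ y
  ... | yes refl = cancel (env x) (⟦ ys ⟧ env)
    where
    cancel : ∀ a c → c ≡ a xor (a xor c)
    cancel = solve-∀ 𝔹-ring
  ... | no _ = trans (cong (env y xor_) (insert-sound env x ys)) (swap (env y) (env x) (⟦ ys ⟧ env))
    where
    swap : ∀ a b c → a xor (b xor c) ≡ b xor (a xor c)
    swap = solve-∀ 𝔹-ring

  normalise-sound : ∀ env xs → ⟦ normalise xs ⟧ env ≡ ⟦ xs ⟧ env
  normalise-sound env []       = refl
  normalise-sound env (x ∷ xs) =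
    trans (insert-sound env x (normalise xs)) (cong (env x xor_) (normalise-sound env xs))

module K5Parity where

  open import Data.Fin using (Fin; _<?_; _≟_)
  open import Data.Fin.Patterns using (0F; 1F; 2F; 3F; 4F)
  open import Data.List using (List; []; _∷_; _++_; concatMap)
  open import Data.List.Relation.Unary.All as All using (All; all?)
  open import Data.Bool using (Bool; true; false; _xor_)
  open import Data.Bool.Properties using (xor-identityʳ)
  open import Data.Product using (_×_; _,_)
  open import Relation.Nullary using (¬_; does; yes; no; ¬?; _×-dec_)
  open import Relation.Nullary.Decidable using (from-yes; map′)
  open import Relation.Unary using (Decidable)
  open import Relation.Binary.PropositionalEquality

  Quad : Set
  Quad = Fin 5 × Fin 5 × Fin 5 × Fin 5

  Independent : Quad → Set
  Independent (a , b , c , d) = a ≢ b × c ≢ d × a ≢ c × a ≢ d × b ≢ c × b ≢ d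

  independent? : Decidable Independent
  independent? (a , b , c , d) =
    ¬? (a ≟ b) ×-dec ¬? (c ≟ d) ×-dec ¬? (a ≟ c) ×-dec ¬? (a ≟ d) ×-dec ¬? (b ≟ c) ×-dec ¬? (b ≟ d)

  independentPairs : List Quad
  independentPairs =
    (0F , 1F , 2F , 3F) ∷ (0F , 1F , 2F , 4F) ∷ (0F , 1F , 3F , 4F) ∷
    (0F , 2F , 1F , 3F) ∷ (0F , 2F , 1F , 4F) ∷ (0F , 2F , 3F , 4F) ∷
    (0F , 3F , 1F , 2F) ∷ (0F , 3F , 1F , 4F) ∷ (0F , 3F , 2F , 4F) ∷
    (0F , 4F , 1F , 2F) ∷ (0F , 4F , 1F , 3F) ∷ (0F , 4F , 2F , 3F) ∷
    (1F , 2F , 3F , 4F) ∷ (1F , 3F , 2F , 4F) ∷ (1F , 4F , 2F , 3F) ∷ []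

  independentPairs-independent : All Independent independentPairs
  independentPairs-independent = from-yes (all? independent? independentPairs)

  data Atom : Set where
    one       : Atom
    rayAtom   : Fin 5 → Fin 5 → Fin 5 → Atom
    belowAtom : Fin 5 → Fin 5 → Atom

  _≟ᴬ_ : DecidableEquality Atom
  one ≟ᴬ one = yes refl
  rayAtom v i j ≟ᴬ rayAtom v′ i′ j′ =
    map′ (λ { (refl , refl , refl) → refl }) (λ { refl → refl , refl , refl })
         (v ≟ v′ ×-dec i ≟ i′ ×-dec j ≟ j′)
  belowAtom i j ≟ᴬ belowAtom i′ j′ =
    map′ (λ { (refl , refl) → refl }) (λ { refl → refl , refl }) (i ≟ i′ ×-dec j ≟ j′)
  one           ≟ᴬ rayAtom _ _ _ = no λ ()
  one           ≟ᴬ belowAtom _ _ = no λ ()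
  rayAtom _ _ _ ≟ᴬ one           = no λ ()
  rayAtom _ _ _ ≟ᴬ belowAtom _ _ = no λ ()
  belowAtom _ _ ≟ᴬ one           = no λ ()
  belowAtom _ _ ≟ᴬ rayAtom _ _ _ = no λ ()

  open XorNormalForm _≟ᴬ_

  -- below j i is rewritten as one xor below i j for i < j, so that only one of the two occurs
  belowTerms : Fin 5 → Fin 5 → List Atom
  belowTerms i j with does (j <? i)
  ... | true  = one ∷ belowAtom j i ∷ []
  ... | false = belowAtom i j ∷ []

  linkingTerms : Quad → List Atom
  linkingTerms (a , b , c , d) =
    rayAtom a c d ∷ rayAtom b c d ∷ rayAtom c a b ∷ rayAtom d a b ∷
    belowTerms a c ++ belowTerms b c ++ belowTerms a d ++ belowTerms b d

  linkingTerms-cancel : normalise (concatMap linkingTerms independentPairs) ≡ one ∷ []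
  linkingTerms-cancel = refl

  module _ (ray : Fin 5 → Fin 5 → Fin 5 → Bool) (below : Fin 5 → Fin 5 → Bool) where

    linking : Quad → Bool
    linking (a , b , c , d) =
      ray a c d xor ray b c d xor ray c a b xor ray d a b xor
      below a c xor below b c xor below a d xor below b d

    env : Atom → Bool
    env one             = true
    env (rayAtom v i j) = ray v i j
    env (belowAtom i j) = below i j

    module _ (below-flip : ∀ {i j} → i ≢ j → below j i ≡ true xor below i j) where

      belowTerms-sound : ∀ i j → i ≢ j → ⟦ belowTerms i j ⟧ env ≡ below i j
      belowTerms-sound i j i≢j with does (j <? i)
      ... | true  = trans (cong (true xor_) (xor-identityʳ (below j i))) (sym (below-flip (≢-sym i≢j)))
      ... | false = xor-identityʳ (below i j)

      linkingTerms-sound : ∀ q → Independent q → ⟦ linkingTerms q ⟧ env ≡ linking q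
      linkingTerms-sound (a , b , c , d) (_ , _ , a≢c , a≢d , b≢c , b≢d) =
        cong (λ z → ray a c d xor ray b c d xor ray c a b xor ray d a b xor z) (begin
          ⟦ belowTerms a c ++ belowTerms b c ++ belowTerms a d ++ belowTerms b d ⟧ env
            ≡⟨ ⟦++⟧ (belowTerms a c) _ env ⟩
          ⟦ belowTerms a c ⟧ env xor ⟦ belowTerms b c ++ belowTerms a d ++ belowTerms b d ⟧ env
            ≡⟨ cong (⟦ belowTerms a c ⟧ env xor_) (⟦++⟧ (belowTerms b c) _ env) ⟩
          ⟦ belowTerms a c ⟧ env xor (⟦ belowTerms b c ⟧ env xor ⟦ belowTerms a d ++ belowTerms b d ⟧ env)
            ≡⟨ cong (λ z → ⟦ belowTerms a c ⟧ env xor (⟦ belowTerms b c ⟧ env xor z))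
                    (⟦++⟧ (belowTerms a d) _ env) ⟩
          ⟦ belowTerms a c ⟧ env xor (⟦ belowTerms b c ⟧ env xor
            (⟦ belowTerms a d ⟧ env xor ⟦ belowTerms b d ⟧ env))
            ≡⟨ cong₂ _xor_ (belowTerms-sound a c a≢c) (cong₂ _xor_ (belowTerms-sound b c b≢c)
                 (cong₂ _xor_ (belowTerms-sound a d a≢d) (belowTerms-sound b d b≢d))) ⟩
          below a c xor below b c xor below a d xor below b d ∎)
        where open ≡-Reasoning

      -- Every ray atom occurs twice and cancels; the height comparisons leave an odd constant.
      K5-linked : ¬ All (λ q → linking q ≡ false) independentPairs
      K5-linked unlinked = true≢false (begin
        true                      ≡⟨⟩
        ⟦ one ∷ [] ⟧ env          ≡⟨ cong (λ xs → ⟦ xs ⟧ env) linkingTerms-cancel ⟨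
        ⟦ normalise allTerms ⟧ env ≡⟨ normalise-sound env allTerms ⟩
        ⟦ allTerms ⟧ env           ≡⟨ ⟦concatMap⟧-false linkingTerms env terms≡false ⟩
        false                     ∎)
        where
        open ≡-Reasoning
        allTerms = concatMap linkingTerms independentPairs
        true≢false : true ≢ false
        true≢false ()
        terms≡false : All (λ q → ⟦ linkingTerms q ⟧ env ≡ false) independentPairs
        terms≡false = All.zipWith (λ {q} (ind , h) → trans (linkingTerms-sound q ind) h)
                                  (independentPairs-independent , unlinked)

module Polylines where

  open import Defs using (Point; Polyline)
  open import Data.Fin using (zero; suc; inject₁)
  open import Data.List using (List; tabulate)
  open import Data.Product using (_,_)
  open import Data.Rational using (ℚ)
  open import Function using (_∘_)
  open Segments using (onSeg-start; onSeg-end)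
  open Shear using (shear)

  breakpoint-onLine : ∀ A i → Polyline.OnLine A (Polyline.pts A i)
  breakpoint-onLine A zero    = zero , onSeg-start (Polyline.pts A zero) (Polyline.pts A (suc zero))
  breakpoint-onLine A (suc i) = i , onSeg-end (Polyline.pts A (inject₁ i)) (Polyline.pts A (suc i))

  shearPolyline : ℚ → Polyline → Polyline
  shearPolyline δ A = record { k = Polyline.k A ; pts = shear δ ∘ Polyline.pts A }

  breakpoints : Polyline → List Point
  breakpoints A = tabulate (Polyline.pts A)

module DrawingFacts where

  open import Defs
  open import Data.Nat using (ℕ)
  open import Data.Fin using (Fin)
  open import Data.Rational using (_≟_)
  open import Data.Product using (_,_; proj₁; proj₂)
  open import Data.Product.Properties using (≡-dec)
  open import Data.Sum using (inj₁; inj₂)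
  open import Relation.Nullary using (¬_; yes; no)
  open import Relation.Binary.Definitions using (DecidableEquality)
  open import Relation.Binary.PropositionalEquality

  _≟ₚ_ : DecidableEquality Point
  _≟ₚ_ = ≡-dec _≟_ _≟_

  module _ {N : ℕ} {Adj : Fin N → Fin N → Set} (D : PlaneDrawing N Adj) where

    open PlaneDrawing D

    vertex-off-arc : ∀ {u v} (e : Adj u v) w → w ≢ u → w ≢ v → ¬ Polyline.OnLine (arc u v e) (pos w)
    vertex-off-arc {u} {v} e w w≢u w≢v on = no-vertex u v e w
      (on , (λ w≡s → w≢u (pos-inj w u (trans w≡s (proj₁ (ends u v e))))) ,
            (λ w≡t → w≢v (pos-inj w v (trans w≡t (proj₂ (ends u v e))))))

    independent-arcs-disjoint : ∀ {u v u′ v′} (e : Adj u v) (e′ : Adj u′ v′) →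
      u ≢ u′ → u ≢ v′ → v ≢ u′ → v ≢ v′ →
      ∀ x → Polyline.OnLine (arc u v e) x → ¬ Polyline.OnLine (arc u′ v′ e′) x
    independent-arcs-disjoint {u} {v} {u′} {v′} e e′ u≢u′ u≢v′ v≢u′ v≢v′ x on on′
      with x ≟ₚ Polyline.start (arc u v e) | x ≟ₚ Polyline.end (arc u v e)
    ... | yes x≡start | _ = vertex-off-arc e′ u u≢u′ u≢v′
                              (subst (Polyline.OnLine (arc u′ v′ e′)) (trans x≡start (proj₁ (ends u v e))) on′)
    ... | no _ | yes x≡end = vertex-off-arc e′ v v≢u′ v≢v′
                              (subst (Polyline.OnLine (arc u′ v′ e′)) (trans x≡end (proj₂ (ends u v e))) on′)
    ... | no x≢start | no x≢end =
      no-cross u v e u′ v′ e′ (λ { (inj₁ (u≡u′ , _)) → u≢u′ u≡u′ ; (inj₂ (u≡v′ , _)) → u≢v′ u≡v′ })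
               x (on , x≢start , x≢end) on′

module ShearedLinking where

  open import Defs using (Point; Polyline)
  open import Data.Fin using (inject₁; suc)
  open import Data.Bool using (false)
  open import Data.Product using (_,_)
  open import Relation.Nullary using (¬_)
  open import Relation.Binary.PropositionalEquality
  open Polyline using (pts; OnLine)
  open Segments using (Y)
  open Shear using (shear; unshear; onSeg-unshear)
  open Linking using (linkingParity; linkingParity-disjoint)
  open Polylines

  -- disjointness survives the shear because unshear maps sheared segments back to the originals
  sheared-linkingParity : ∀ δ A B {P : Point → Set} →
    (∀ i → pts A (inject₁ i) ≢ pts A (suc i)) →
    (∀ j → pts B (inject₁ j) ≢ pts B (suc j)) →
    (∀ x → OnLine A x → ¬ OnLine B x) →
    (∀ i → P (pts A i)) → (∀ j → P (pts B j)) →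
    (∀ {p q} → P p → P q → p ≢ q → Y (shear δ p) ≢ Y (shear δ q)) →
    linkingParity (shearPolyline δ A) (shearPolyline δ B) ≡ false
  sheared-linkingParity δ A B nondeg-A nondeg-B disjoint A∈P B∈P generic =
    linkingParity-disjoint (shearPolyline δ A) (shearPolyline δ B)
      (λ i → generic (A∈P _) (A∈P _) (nondeg-A i))
      (λ j → generic (B∈P _) (B∈P _) (nondeg-B j))
      (λ i j → generic (A∈P i) (B∈P j) (λ Aᵢ≡Bⱼ → disjoint (pts A i) (breakpoint-onLine A i)
                                            (subst (OnLine B) (sym Aᵢ≡Bⱼ) (breakpoint-onLine B j))))
      (λ i j (x , on-A , on-B) → disjoint (unshear δ x)
        (i , onSeg-unshear δ (pts A (inject₁ i)) (pts A (suc i)) x on-A)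
        (j , onSeg-unshear δ (pts B (inject₁ j)) (pts B (suc j)) x on-B))

module K5NotDrawable where

  open import Defs
  open import Data.Nat using (ℕ)
  open import Data.Fin using (Fin; zero; _≟_)
  open import Data.Bool using (Bool; true; false; _xor_)
  open import Data.List using (List; concatMap; cartesianProduct; allFin)
  open import Data.List.Membership.Propositional using (_∈_; lose)
  open import Data.List.Membership.Propositional.Properties
    using (∈-concatMap⁺; ∈-cartesianProduct⁺; ∈-allFin; ∈-tabulate⁺)
  open import Data.List.Relation.Unary.All as All using (All)
  open import Data.Product using (_,_; proj₁; proj₂)
  open import Data.Empty using (⊥; ⊥-elim)
  open import Relation.Nullary using (¬_; yes; no)
  open import Relation.Binary.PropositionalEquality
  open Polyline using (pts; start; end; OnLine)
  open Shear using (shear; generic-shear)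
  open CrossingParity using (below; below-flip)
  open Linking using (rayParity; linkingParity-endpoints)
  open K5Parity using (Independent; independentPairs; independentPairs-independent; linking; K5-linked)
  open Polylines
  open DrawingFacts using (independent-arcs-disjoint)
  open ShearedLinking using (sheared-linkingParity)

  module _ {N : ℕ} {Adj : Fin N → Fin N → Set} (D : PlaneDrawing N Adj) (u : Fin 5 → Fin N)
           (u-injective : ∀ {i j} → i ≢ j → u i ≢ u j)
           (clique : ∀ {i j} → i ≢ j → Adj (u i) (u j)) where

    open PlaneDrawing D

    -- On the diagonal, where there is no edge, the one-point polyline at the vertex;
    -- this puts every vertex among the breakpoints.
    edgeArc : Fin 5 → Fin 5 → Polyline
    edgeArc i j with i ≟ j
    ... | yes _  = record { k = 0 ; pts = λ _ → pos (u i) }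
    ... | no i≢j = arc (u i) (u j) (clique i≢j)

    edgeArc-diagonal : ∀ i → pts (edgeArc i i) zero ≡ pos (u i)
    edgeArc-diagonal i with i ≟ i
    ... | yes _   = refl
    ... | no i≢i = ⊥-elim (i≢i refl)

    edgeArc-isArc : ∀ {i j} → i ≢ j → IsArc (edgeArc i j)
    edgeArc-isArc {i} {j} i≢j with i ≟ j
    ... | yes i≡j  = ⊥-elim (i≢j i≡j)
    ... | no i≢j′ = isArc (u i) (u j) (clique i≢j′)

    edgeArc-start : ∀ {i j} → i ≢ j → start (edgeArc i j) ≡ pos (u i)
    edgeArc-start {i} {j} i≢j with i ≟ j
    ... | yes i≡j  = ⊥-elim (i≢j i≡j)
    ... | no i≢j′ = proj₁ (ends (u i) (u j) (clique i≢j′))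

    edgeArc-end : ∀ {i j} → i ≢ j → end (edgeArc i j) ≡ pos (u j)
    edgeArc-end {i} {j} i≢j with i ≟ j
    ... | yes i≡j  = ⊥-elim (i≢j i≡j)
    ... | no i≢j′ = proj₂ (ends (u i) (u j) (clique i≢j′))

    edgeArcs-disjoint : ∀ {a b c d} → Independent (a , b , c , d) →
                        ∀ x → OnLine (edgeArc a b) x → ¬ OnLine (edgeArc c d) x
    edgeArcs-disjoint {a} {b} {c} {d} (a≢b , c≢d , a≢c , a≢d , b≢c , b≢d) with a ≟ b | c ≟ d
    ... | yes a≡b | _        = ⊥-elim (a≢b a≡b)
    ... | no _    | yes c≡d  = ⊥-elim (c≢d c≡d)
    ... | no a≢b′ | no c≢d′ =
      independent-arcs-disjoint D (clique a≢b′) (clique c≢d′)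
        (u-injective a≢c) (u-injective a≢d) (u-injective b≢c) (u-injective b≢d)

    allBreakpoints : List Point
    allBreakpoints =
      concatMap (λ (i , j) → breakpoints (edgeArc i j)) (cartesianProduct (allFin 5) (allFin 5))

    breakpoint∈ : ∀ i j s → pts (edgeArc i j) s ∈ allBreakpoints
    breakpoint∈ i j s =
      ∈-concatMap⁺ (λ (i , j) → breakpoints (edgeArc i j)) (lose (∈-cartesianProduct⁺ (∈-allFin i) (∈-allFin j))
                                                            (∈-tabulate⁺ {f = pts (edgeArc i j)} s))

    vertex∈ : ∀ i → pos (u i) ∈ allBreakpoints
    vertex∈ i = subst (_∈ allBreakpoints) (edgeArc-diagonal i) (breakpoint∈ i i zero)

    δ = proj₁ (generic-shear allBreakpoints)
    generic = proj₂ (generic-shear allBreakpoints)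

    vertex : Fin 5 → Point
    vertex i = shear δ (pos (u i))

    ray : Fin 5 → Fin 5 → Fin 5 → Bool
    ray v i j = rayParity (vertex v) (shearPolyline δ (edgeArc i j))

    vertexBelow : Fin 5 → Fin 5 → Bool
    vertexBelow i j = below (vertex i) (vertex j)

    vertexBelow-flip : ∀ {i j} → i ≢ j → vertexBelow j i ≡ true xor vertexBelow i j
    vertexBelow-flip {i} {j} i≢j = below-flip (vertex i) (vertex j)
      (generic (vertex∈ i) (vertex∈ j) (λ same → u-injective i≢j (pos-inj (u i) (u j) same)))

    unlinked : ∀ q → Independent q → linking ray vertexBelow q ≡ false
    unlinked (a , b , c , d) ind@(a≢b , c≢d , _) =
      trans (sym (linkingParity-endpoints (shearPolyline δ (edgeArc a b)) (shearPolyline δ (edgeArc c d))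
                   (cong (shear δ) (edgeArc-start a≢b)) (cong (shear δ) (edgeArc-end a≢b))
                   (cong (shear δ) (edgeArc-start c≢d)) (cong (shear δ) (edgeArc-end c≢d))))
            (sheared-linkingParity δ (edgeArc a b) (edgeArc c d)
              (IsArc.nondeg (edgeArc-isArc a≢b)) (IsArc.nondeg (edgeArc-isArc c≢d))
              (edgeArcs-disjoint ind) (breakpoint∈ a b) (breakpoint∈ c d) generic)

    K5-not-drawable : ⊥
    K5-not-drawable =
      K5-linked ray vertexBelow vertexBelow-flip (All.map (λ {q} → unlinked q) independentPairs-independent)

module CyclicPart where

  open import Defs
  open import Data.Nat as ℕ using (zero; suc; _+_; _*_; _∸_; _<_; NonZero)
  open import Data.Nat.Properties using (<⇒<ᵇ; m^n≢0; *-suc; *-identityʳ)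
  open import Data.Nat.DivMod using (_%_; %-distribˡ-+; m%n%n≡m%n; m%n<n; m<n⇒m%n≡m)
  open import Data.Bool using (true)
  open import Data.Bool.Properties using (T-≡)
  open import Function.Bundles using (Equivalence)
  open import Relation.Binary.PropositionalEquality

  inP-true : ∀ n {i} → i < mOf n → inP n i ≡ true
  inP-true n i<m = Equivalence.to T-≡ (<⇒<ᵇ i<m)

  op-P : ∀ n {i j} → i < mOf n → j < mOf n → op n i j ≡ modm n (i + j)
  op-P n i<m j<m rewrite inP-true n i<m | inP-true n j<m = refl

  modm-+ : ∀ n a b → modm n (a + modm n b) ≡ modm n (a + b)
  modm-+ n a b = begin
    (a + b % m) % m           ≡⟨ %-distribˡ-+ a (b % m) m ⟩
    (a % m + b % m % m) % m   ≡⟨ cong (λ z → (a % m + z) % m) (m%n%n≡m%n b m) ⟩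
    (a % m + b % m) % m       ≡⟨ %-distribˡ-+ a b m ⟨
    (a + b) % m               ∎
    where
    open ≡-Reasoning
    m = mOf n
    instance
      m≢0 : NonZero m
      m≢0 = m^n≢0 2 (n ∸ 1)

  pow-P : ∀ n {a} → a < mOf n → ∀ k → pow n a (suc k) ≡ modm n (a * suc k)
  pow-P n {a} a<m zero = sym (trans (cong (modm n) (*-identityʳ a)) (m<n⇒m%n≡m {{m^n≢0 2 (n ∸ 1)}} a<m))
  pow-P n {a} a<m (suc k) = begin
    op n a (pow n a (suc k))      ≡⟨ cong (op n a) (pow-P n a<m k) ⟩
    op n a (modm n (a * suc k))   ≡⟨ op-P n a<m (m%n<n (a * suc k) (mOf n) {{m^n≢0 2 (n ∸ 1)}}) ⟩
    modm n (a + modm n (a * suc k)) ≡⟨ modm-+ n a (a * suc k) ⟩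
    modm n (a + a * suc k)        ≡⟨ cong (modm n) (*-suc a (suc k)) ⟨
    modm n (a * suc (suc k))      ∎
    where open ≡-Reasoning

module PowerGraphAdjacency where

  open import Defs
  open import Data.Nat using (suc; _^_; s≤s; z≤n)
  open import Data.Fin using (Fin; toℕ)
  open import Data.Product using (_,_)
  open import Data.Sum using (inj₁; inj₂)
  open import Relation.Binary.PropositionalEquality

  PGAdj-sym : ∀ n {u v} → PGAdj n u v → PGAdj n v u
  PGAdj-sym n (u≢v , k , k≥1 , inj₁ uᵏ≡v) = ≢-sym u≢v , k , k≥1 , inj₂ uᵏ≡v
  PGAdj-sym n (u≢v , k , k≥1 , inj₂ vᵏ≡u) = ≢-sym u≢v , k , k≥1 , inj₁ vᵏ≡u

  power-adjacent : ∀ n {u v : Fin (2 ^ n)} → u ≢ v → ∀ k → pow n (toℕ u) (suc k) ≡ toℕ v →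
                   PGAdj n u v
  power-adjacent n u≢v k uᵏ≡v = u≢v , suc k , s≤s z≤n , inj₁ uᵏ≡v

module K5InPowerGraph (n′ e : ℕ) (2^n′≡8+e : 2 ℕ.^ n′ ≡ 8 ℕ.+ e) where

  open import Defs
  open import Data.Nat as ℕ using (ℕ; suc; _+_; _*_; _^_; _<_; NonZero)
  open import Data.Nat.Properties using (≤-refl; <-≤-trans; m≤m+n; *-identityˡ; m^n≢0)
  open import Data.Nat.DivMod using (_%_; m*n%n≡0; [m+kn]%n≡m%n; m<n⇒m%n≡m)
  open import Data.Nat.Tactic.RingSolver using (solve-∀)
  open import Data.Fin using (Fin; toℕ; fromℕ<)
  open import Data.Fin.Properties using (toℕ-fromℕ<)
  open import Data.Fin.Patterns using (0F; 1F; 2F; 3F; 4F)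
  open import Data.Product using (Σ; _,_)
  open import Data.Sum using (_⊎_; inj₁; inj₂; swap)
  open import Data.Empty using (⊥-elim)
  open import Relation.Binary.PropositionalEquality
  open CyclicPart using (pow-P)
  open PowerGraphAdjacency

  n m : ℕ
  n = suc n′
  m = 8 + e

  value : Fin 5 → ℕ
  value 0F = 0
  value 1F = 1
  value 2F = 2
  value 3F = 4
  value 4F = 7 + e

  value<m : ∀ i → value i < m
  value<m 0F = ℕ.s≤s ℕ.z≤n
  value<m 1F = ℕ.s≤s (ℕ.s≤s ℕ.z≤n)
  value<m 2F = ℕ.s≤s (ℕ.s≤s (ℕ.s≤s ℕ.z≤n))
  value<m 3F = ℕ.s≤s (ℕ.s≤s (ℕ.s≤s (ℕ.s≤s (ℕ.s≤s ℕ.z≤n))))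
  value<m 4F = ≤-refl

  index : ℕ → Fin 5
  index 0 = 0F
  index 1 = 1F
  index 2 = 2F
  index 4 = 3F
  index _ = 4F

  index-value : ∀ i → index (value i) ≡ i
  index-value 0F = refl
  index-value 1F = refl
  index-value 2F = refl
  index-value 3F = refl
  index-value 4F = refl

  u : Fin 5 → Fin (2 ^ n)
  u i = fromℕ< (<-≤-trans (subst (value i <_) (sym 2^n′≡8+e) (value<m i)) (m≤m+n (2 ^ n′) _))

  toℕ-u : ∀ i → toℕ (u i) ≡ value i
  toℕ-u i = toℕ-fromℕ< _

  u-injective : ∀ {i j} → i ≢ j → u i ≢ u j
  u-injective {i} {j} i≢j uᵢ≡uⱼ = i≢j (begin
    i                 ≡⟨ index-value i ⟨
    index (value i)   ≡⟨ cong index (trans (sym (toℕ-u i)) (trans (cong toℕ uᵢ≡uⱼ) (toℕ-u j))) ⟩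
    index (value j)   ≡⟨ index-value j ⟩
    j                 ∎)
    where open ≡-Reasoning

  pow-mod-m : ∀ {a} → a < m → ∀ k → pow n a (suc k) ≡ (a * suc k) % m
  pow-mod-m {a} a<m k = trans (pow-P n (subst (a <_) (sym 2^n′≡8+e) a<m) k) (mod-m (a * suc k) 2^n′≡8+e {{m^n≢0 2 n′}})
    where
    mod-m : ∀ x {M M′} → M ≡ M′ → .{{_ : NonZero M}} → .{{_ : NonZero M′}} → x % M ≡ x % M′
    mod-m x refl = refl

  pow-m≡0 : ∀ {a} → a < m → pow n a m ≡ 0
  pow-m≡0 {a} a<m = trans (pow-mod-m a<m (7 + e)) (m*n%n≡0 a m)

  pow-one : ∀ x → suc x < m → pow n 1 (suc x) ≡ suc x
  pow-one x x<m = trans (pow-mod-m (value<m 1F) x)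
                        (trans (cong (_% m) (*-identityˡ (suc x))) (m<n⇒m%n≡m x<m))

  -- (j + r) (1 + r) = j + r (1 + j + r): the element m - 1 = j + r has j as its (1 + r)-th power
  pow-minus-one : ∀ j r → suc (j + r) ≡ m → j < m → pow n (j + r) (suc r) ≡ j
  pow-minus-one j r m≡ j<m = begin
    pow n (j + r) (suc r)        ≡⟨ pow-mod-m (subst (j + r <_) m≡ ≤-refl) r ⟩
    ((j + r) * suc r) % m        ≡⟨ cong (_% m) (expand j r) ⟩
    (j + r * suc (j + r)) % m    ≡⟨ cong (λ M → (j + r * M) % m) m≡ ⟩
    (j + r * m) % m              ≡⟨ [m+kn]%n≡m%n j r m ⟩
    j % m                        ≡⟨ m<n⇒m%n≡m j<m ⟩
    j                            ∎
    where
    open ≡-Reasoning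
    expand : ∀ j r → (j + r) * suc r ≡ j + r * suc (j + r)
    expand = solve-∀

  PowerOf : Fin 5 → Fin 5 → Set
  PowerOf i j = Σ ℕ λ k → pow n (value i) (suc k) ≡ value j

  power-table : ∀ i j → i ≢ j → PowerOf i j ⊎ PowerOf j i
  power-table 0F 1F _ = inj₂ (7 + e , pow-m≡0 (value<m 1F))
  power-table 0F 2F _ = inj₂ (7 + e , pow-m≡0 (value<m 2F))
  power-table 0F 3F _ = inj₂ (7 + e , pow-m≡0 (value<m 3F))
  power-table 0F 4F _ = inj₂ (7 + e , pow-m≡0 (value<m 4F))
  power-table 1F 2F _ = inj₁ (1 , pow-one 1 (value<m 2F))
  power-table 1F 3F _ = inj₁ (3 , pow-one 3 (value<m 3F))
  power-table 1F 4F _ = inj₁ (6 + e , pow-one (6 + e) (value<m 4F))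
  power-table 2F 3F _ = inj₁ (1 , trans (pow-mod-m (value<m 2F) 1) (m<n⇒m%n≡m (value<m 3F)))
  power-table 2F 4F _ = inj₂ (5 + e , pow-minus-one 2 (5 + e) refl (value<m 2F))
  power-table 3F 4F _ = inj₂ (3 + e , pow-minus-one 4 (3 + e) refl (value<m 3F))
  power-table 1F 0F i≢j = swap (power-table 0F 1F (≢-sym i≢j))
  power-table 2F 0F i≢j = swap (power-table 0F 2F (≢-sym i≢j))
  power-table 3F 0F i≢j = swap (power-table 0F 3F (≢-sym i≢j))
  power-table 4F 0F i≢j = swap (power-table 0F 4F (≢-sym i≢j))
  power-table 2F 1F i≢j = swap (power-table 1F 2F (≢-sym i≢j))
  power-table 3F 1F i≢j = swap (power-table 1F 3F (≢-sym i≢j))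
  power-table 4F 1F i≢j = swap (power-table 1F 4F (≢-sym i≢j))
  power-table 3F 2F i≢j = swap (power-table 2F 3F (≢-sym i≢j))
  power-table 4F 2F i≢j = swap (power-table 2F 4F (≢-sym i≢j))
  power-table 4F 3F i≢j = swap (power-table 3F 4F (≢-sym i≢j))
  power-table 0F 0F i≢i = ⊥-elim (i≢i refl)
  power-table 1F 1F i≢i = ⊥-elim (i≢i refl)
  power-table 2F 2F i≢i = ⊥-elim (i≢i refl)
  power-table 3F 3F i≢i = ⊥-elim (i≢i refl)
  power-table 4F 4F i≢i = ⊥-elim (i≢i refl)

  as-u : ∀ i j {k} → pow n (value i) (suc k) ≡ value j → pow n (toℕ (u i)) (suc k) ≡ toℕ (u j)
  as-u i j {k} p = trans (cong (λ a → pow n a (suc k)) (toℕ-u i)) (trans p (sym (toℕ-u j)))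

  clique : ∀ {i j} → i ≢ j → PGAdj n (u i) (u j)
  clique {i} {j} i≢j with power-table i j i≢j
  ... | inj₁ (k , p) = power-adjacent n (u-injective i≢j) k (as-u i j {k} p)
  ... | inj₂ (k , p) = PGAdj-sym n (power-adjacent n (u-injective (≢-sym i≢j)) k (as-u j i {k} p))

module PowerGraphNonPlanar where

  open import Defs
  open import Data.Nat using (suc; _≤_; _^_; _∸_; s≤s)
  open import Data.Nat.Properties using (^-monoʳ-≤; m+[n∸m]≡n)
  open import Relation.Binary.PropositionalEquality using (sym)
  open import Relation.Nullary using (¬_)
  open K5NotDrawable using (K5-not-drawable)

  -- for n ≥ 4 the modulus m = 2 ^ (n - 1) is at least 8
  power-graph-nonplanar : ∀ n → 4 ≤ n → ¬ Planar (2 ^ n) (PGAdj n)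
  power-graph-nonplanar (suc n′) (s≤s 3≤n′) D = K5-not-drawable D u u-injective clique
    where open K5InPowerGraph n′ (2 ^ n′ ∸ 8) (sym (m+[n∸m]≡n (^-monoʳ-≤ 2 3≤n′)))

module SeparatingLines where

  open import Defs using (Point; OnSeg)
  open import Data.Rational
  open import Data.Rational.Properties
  open import Data.Product using (_×_; _,_; proj₁; proj₂)
  open import Data.Empty using (⊥-elim)
  open import Relation.Binary.Definitions using (tri<; tri≈; tri>)
  open import Data.Sum using (_⊎_; inj₁; inj₂)
  open import Relation.Binary.PropositionalEquality
  open import Relation.Nullary using (¬_; Dec; _×-dec_; _⊎-dec_)
  open import Tactic.RingSolver using (solve-∀)
  open RationalArith
  open Segments using (X; Y)

  record Line : Set where
    constructor line
    field
      α β γ : ℚ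

  eval : Line → Point → ℚ
  eval (line α β γ) p = α * X p + β * Y p + γ

  eval-onSeg : ∀ L {a b x} ((t , _) : OnSeg a b x) →
               eval L x ≡ (1ℚ - t) * eval L a + t * eval L b
  eval-onSeg (line α β γ) {ax , ay} {bx , by} (t , _ , _ , ex , ey) =
    trans (cong₂ (λ u v → α * u + β * v + γ) ex ey) (affine α β γ ax ay bx by t)
    where
    affine : ∀ α β γ ax ay bx by t → α * (ax + t * (bx - ax)) + β * (ay + t * (by - ay)) + γ
           ≡ (1ℚ - t) * (α * ax + β * ay + γ) + t * (α * bx + β * by + γ)
    affine = solve-∀ ℚ-ring

  Separates : Line → Point → Point → Point → Point → Set
  Separates L a b c d =
    ((((0ℚ < eval L a) × (0ℚ ≤ eval L b)) ⊎ ((0ℚ ≤ eval L a) × (0ℚ < eval L b))) ×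
      (eval L c ≤ 0ℚ) × (eval L d ≤ 0ℚ)) ⊎
    (((0ℚ ≤ eval L a) × (0ℚ ≤ eval L b)) × (eval L c < 0ℚ) × (eval L d < 0ℚ))

  separates? : ∀ L a b c d → Dec (Separates L a b c d)
  separates? L a b c d =
    ((((0ℚ <? eval L a) ×-dec (0ℚ ≤? eval L b)) ⊎-dec ((0ℚ ≤? eval L a) ×-dec (0ℚ <? eval L b))) ×-dec
      (eval L c ≤? 0ℚ) ×-dec (eval L d ≤? 0ℚ)) ⊎-dec
    (((0ℚ ≤? eval L a) ×-dec (0ℚ ≤? eval L b)) ×-dec (eval L c <? 0ℚ) ×-dec (eval L d <? 0ℚ))

  private
    convex-nonNeg : ∀ {s p q} → 0ℚ ≤ s → s ≤ 1ℚ → 0ℚ ≤ p → 0ℚ ≤ q → 0ℚ ≤ (1ℚ - s) * p + s * q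
    convex-nonNeg s≥0 s≤1 p≥0 q≥0 = +-mono-≤ (*-nonNeg (p≤q⇒0≤q-p s≤1) p≥0) (*-nonNeg s≥0 q≥0)

    convex-pos : ∀ {s p q} → 0ℚ ≤ s → s ≤ 1ℚ → 0ℚ < p → 0ℚ < q → 0ℚ < (1ℚ - s) * p + s * q
    convex-pos {s} {p} {q} s≥0 s≤1 p>0 q>0 with <-cmp 0ℚ s
    ... | tri< s>0 _ _ = +-mono-≤-< (*-nonNeg (p≤q⇒0≤q-p s≤1) (<⇒≤ p>0)) (*-pos s>0 q>0)
    ... | tri≈ _ refl _ = subst (0ℚ <_) (sym (at-0 p q)) p>0
      where
      at-0 : ∀ p q → (1ℚ - 0ℚ) * p + 0ℚ * q ≡ p
      at-0 = solve-∀ ℚ-ring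
    ... | tri> _ _ s<0 = ⊥-elim (<-irrefl refl (<-≤-trans s<0 s≥0))

    convex-pos-interior : ∀ {s p q} → 0ℚ < s → s < 1ℚ →
      ((0ℚ < p) × (0ℚ ≤ q)) ⊎ ((0ℚ ≤ p) × (0ℚ < q)) → 0ℚ < (1ℚ - s) * p + s * q
    convex-pos-interior s>0 s<1 (inj₁ (p>0 , q≥0)) =
      +-mono-<-≤ (*-pos (p<q⇒0<q-p s<1) p>0) (*-nonNeg (<⇒≤ s>0) q≥0)
    convex-pos-interior s>0 s<1 (inj₂ (p≥0 , q>0)) =
      +-mono-≤-< (*-nonNeg (p≤q⇒0≤q-p (<⇒≤ s<1)) p≥0) (*-pos s>0 q>0)

    negate-convex : ∀ s p q → - ((1ℚ - s) * p + s * q) ≡ (1ℚ - s) * (- p) + s * (- q)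
    negate-convex = solve-∀ ℚ-ring

    neg-neg : ∀ z → - (- z) ≡ z
    neg-neg = solve-∀ ℚ-ring

    convex-nonPos : ∀ {s p q} → 0ℚ ≤ s → s ≤ 1ℚ → p ≤ 0ℚ → q ≤ 0ℚ → (1ℚ - s) * p + s * q ≤ 0ℚ
    convex-nonPos {s} {p} {q} s≥0 s≤1 p≤0 q≤0 =
      subst (_≤ 0ℚ) (neg-neg _) (neg-antimono-≤ (subst (0ℚ ≤_) (sym (negate-convex s p q))
        (convex-nonNeg s≥0 s≤1 (neg-antimono-≤ p≤0) (neg-antimono-≤ q≤0))))

    convex-neg : ∀ {s p q} → 0ℚ ≤ s → s ≤ 1ℚ → p < 0ℚ → q < 0ℚ → (1ℚ - s) * p + s * q < 0ℚ
    convex-neg {s} {p} {q} s≥0 s≤1 p<0 q<0 =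
      subst (_< 0ℚ) (neg-neg _) (neg-antimono-< (subst (0ℚ <_) (sym (negate-convex s p q))
        (convex-pos s≥0 s≤1 (neg-antimono-< p<0) (neg-antimono-< q<0))))

    interior-parameter : ∀ {a b x} ((t , _) : OnSeg a b x) → x ≢ a → x ≢ b → (0ℚ < t) × (t < 1ℚ)
    interior-parameter {ax , ay} {bx , by} (t , t≥0 , t≤1 , ex , ey) x≢a x≢b =
      strict t≥0 (λ 0≡t → x≢a (cong₂ _,_ (trans ex (at-0 ax bx (sym 0≡t))) (trans ey (at-0 ay by (sym 0≡t))))) ,
      strict t≤1 (λ t≡1 → x≢b (cong₂ _,_ (trans ex (at-1 ax bx t≡1)) (trans ey (at-1 ay by t≡1))))
      where
      at-0′ : ∀ p q → p + 0ℚ * (q - p) ≡ p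
      at-0′ = solve-∀ ℚ-ring
      at-1′ : ∀ p q → p + 1ℚ * (q - p) ≡ q
      at-1′ = solve-∀ ℚ-ring
      at-0 : ∀ p q → t ≡ 0ℚ → p + t * (q - p) ≡ p
      at-0 p q refl = at-0′ p q
      at-1 : ∀ p q → t ≡ 1ℚ → p + t * (q - p) ≡ q
      at-1 p q refl = at-1′ p q
      strict : ∀ {u v} → u ≤ v → u ≢ v → u < v
      strict {u} {v} u≤v u≢v with <-cmp u v
      ... | tri< u<v _ _ = u<v
      ... | tri≈ _ u≡v _ = ⊥-elim (u≢v u≡v)
      ... | tri> _ _ v<u = ⊥-elim (<-irrefl refl (<-≤-trans v<u u≤v))

  separates⇒disjoint : ∀ L {a b c d x} → Separates L a b c d →
                       OnSeg a b x → x ≢ a → x ≢ b → ¬ OnSeg c d x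
  separates⇒disjoint L {a} {b} {c} {d} {x} (inj₁ (ab>0 , c≤0 , d≤0)) on-ab@(t , _) x≢a x≢b on-cd@(s , s≥0 , s≤1 , _) =
    <-irrefl refl (<-≤-trans
      (subst (0ℚ <_) (sym (eval-onSeg L {a} {b} {x} on-ab)) (convex-pos-interior t>0 t<1 ab>0))
      (subst (_≤ 0ℚ) (sym (eval-onSeg L {c} {d} {x} on-cd)) (convex-nonPos s≥0 s≤1 c≤0 d≤0)))
    where
    t>0 = proj₁ (interior-parameter {a} {b} {x} on-ab x≢a x≢b)
    t<1 = proj₂ (interior-parameter {a} {b} {x} on-ab x≢a x≢b)
  separates⇒disjoint L {a} {b} {c} {d} {x} (inj₂ ((a≥0 , b≥0) , c<0 , d<0)) on-ab@(t , t≥0 , t≤1 , _) _ _ on-cd@(s , s≥0 , s≤1 , _) =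
    <-irrefl refl (<-≤-trans
      (subst (_< 0ℚ) (sym (eval-onSeg L {c} {d} {x} on-cd)) (convex-neg s≥0 s≤1 c<0 d<0))
      (subst (0ℚ ≤_) (sym (eval-onSeg L {a} {b} {x} on-ab)) (convex-nonNeg t≥0 t≤1 a≥0 b≥0)))

module DrawingOfG3 where

  open import Defs
  open import Data.Nat using (ℕ; zero; suc)
  open import Data.Nat.Properties using () renaming (_≟_ to _≟ℕ_)
  open import Data.Fin using (Fin; zero; suc; toℕ; _≟_)
  open import Data.Fin.Properties using (all?)
  open import Data.Fin.Patterns using (0F; 1F; 2F; 3F; 4F; 5F; 6F; 7F)
  open import Data.Integer using (ℤ; +_; -[1+_])
  open import Data.Rational using (_/_; _+_; _*_; _-_; -_)
  open import Data.List using (List; []; _∷_)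
  open import Data.List.Membership.DecPropositional _≟ℕ_ using (_∈_; _∈?_)
  open import Data.List.Relation.Unary.All as All using (All)
  open import Data.List.Relation.Unary.Any using (Any; any?; satisfied)
  open import Data.Product using (_×_; _,_)
  open import Data.Sum using (_⊎_; inj₁; inj₂)
  open import Relation.Nullary using (¬_; Dec; ¬?; _×-dec_; _⊎-dec_; _→-dec_)
  open import Relation.Nullary.Decidable using (from-yes)
  open import Relation.Binary.PropositionalEquality
  open Segments using (X; Y; onSeg-start)
  open SeparatingLines
  open DrawingFacts using (_≟ₚ_)

  -- the powers a, a², … of a in G(3): P(3) = ℤ/4, and every element of H(3) has order 2
  powers : ℕ → List ℕ
  powers 0 = 0 ∷ []
  powers 1 = 0 ∷ 1 ∷ 2 ∷ 3 ∷ []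
  powers 2 = 0 ∷ 2 ∷ []
  powers 3 = 0 ∷ 1 ∷ 2 ∷ 3 ∷ []
  powers a = 0 ∷ a ∷ []

  powers-closed : ∀ (u : Fin 8) → All (λ x → op 3 (toℕ u) x ∈ powers (toℕ u)) (powers (toℕ u))
  powers-closed = from-yes (all? {n = 8} λ u → All.all? (λ x → op 3 (toℕ u) x ∈? powers (toℕ u)) (powers (toℕ u)))

  self∈powers : ∀ (u : Fin 8) → toℕ u ∈ powers (toℕ u)
  self∈powers = from-yes (all? {n = 8} λ u → toℕ u ∈? powers (toℕ u))

  pow∈powers : ∀ u k → pow 3 (toℕ u) (suc k) ∈ powers (toℕ u)
  pow∈powers u zero    = self∈powers u
  pow∈powers u (suc k) = All.lookup (powers-closed u) (pow∈powers u k)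

  Edge : Fin 8 → Fin 8 → Set
  Edge u v = u ≢ v × (toℕ v ∈ powers (toℕ u) ⊎ toℕ u ∈ powers (toℕ v))

  PGAdj⇒Edge : ∀ {u v} → PGAdj 3 u v → Edge u v
  PGAdj⇒Edge {u} {v} (u≢v , suc k , _ , inj₁ uᵏ≡v) = u≢v , inj₁ (subst (_∈ _) uᵏ≡v (pow∈powers u k))
  PGAdj⇒Edge {u} {v} (u≢v , suc k , _ , inj₂ vᵏ≡u) = u≢v , inj₂ (subst (_∈ _) vᵏ≡u (pow∈powers v k))

  edge? : ∀ u v → Dec (Edge u v)
  edge? u v = ¬? (u ≟ v) ×-dec (toℕ v ∈? powers (toℕ u) ⊎-dec toℕ u ∈? powers (toℕ v))

  sameEdge? : ∀ (u v u′ v′ : Fin 8) → Dec (SameEdge u v u′ v′)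
  sameEdge? u v u′ v′ = ((u ≟ u′) ×-dec (v ≟ v′)) ⊎-dec ((u ≟ v′) ×-dec (v ≟ u′))

  -- 0 at the centre, the triangle 1, 2, 3 around it and the pendant vertices 4, …, 7 close to 0
  position : Fin 8 → Point
  position u = point (coordinates u)
    where
    point : ℤ × ℤ → Point
    point (x , y) = (x / 1 , y / 1)
    coordinates : Fin 8 → ℤ × ℤ
    coordinates 0F = (+ 0 , + 0)
    coordinates 1F = (+ 0 , + 10)
    coordinates 2F = (+ 10 , -[1+ 9 ])
    coordinates 3F = (-[1+ 9 ] , -[1+ 9 ])
    coordinates 4F = (+ 1 , + 0)
    coordinates 5F = (-[1+ 0 ] , + 0)
    coordinates 6F = (+ 1 , + 1)
    coordinates 7F = (-[1+ 0 ] , + 1)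

  -- positive to the left of the directed line pq
  lineThrough : Point → Point → Line
  lineThrough p q = line (- (Y q - Y p)) (X q - X p) ((Y q - Y p) * X p - (X q - X p) * Y p)

  negLine : Line → Line
  negLine (line α β γ) = line (- α) (- β) (- γ)

  -- zero at w and increasing in the direction from w to a
  towards : Point → Point → Line
  towards w a = line (X a - X w) (Y a - Y w) (- ((X a - X w) * X w + (Y a - Y w) * Y w))

  Separated : Point → Point → Point → Point → Set
  Separated a b c d = Any (λ L → Separates L a b c d) candidates
    where
    candidates : List Line
    candidates = lineThrough c d ∷ negLine (lineThrough c d) ∷ lineThrough a b ∷
                 negLine (lineThrough a b) ∷ towards a b ∷ towards b a ∷ []

  separated? : ∀ a b c d → Dec (Separated a b c d)
  separated? a b c d = any? (λ L → separates? L a b c d) _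

  separated⇒disjoint : ∀ {a b c d x} → Separated a b c d →
                       OnSeg a b x → x ≢ a → x ≢ b → ¬ OnSeg c d x
  separated⇒disjoint sep with satisfied sep
  ... | L , separates = separates⇒disjoint L separates

  edges-separated : ∀ u v u′ v′ → Edge u v → Edge u′ v′ → ¬ SameEdge u v u′ v′ →
                    Separated (position u) (position v) (position u′) (position v′)
  edges-separated = from-yes (all? {n = 8} λ u → all? λ v → all? λ u′ → all? λ v′ →
    edge? u v →-dec edge? u′ v′ →-dec ¬? (sameEdge? u v u′ v′) →-dec
    separated? (position u) (position v) (position u′) (position v′))

  vertices-separated : ∀ u v w → Edge u v → w ≢ u → w ≢ v →
                       Separated (position u) (position v) (position w) (position w)
  vertices-separated = from-yes (all? {n = 8} λ u → all? λ v → all? λ w →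
    edge? u v →-dec ¬? (w ≟ u) →-dec ¬? (w ≟ v) →-dec
    separated? (position u) (position v) (position w) (position w))

  position-injective : ∀ u v → position u ≡ position v → u ≡ v
  position-injective = from-yes (all? {n = 8} λ u → all? λ v → position u ≟ₚ position v →-dec u ≟ v)

  segment : Point → Point → Polyline
  segment p q = record { k = 0 ; pts = λ { zero → p ; (suc _) → q } }

  segment-isArc : ∀ {p q} → p ≢ q → IsArc (segment p q)
  segment-isArc p≢q = record
    { nondeg = λ { zero → p≢q }
    ; consec = λ { zero zero () }
    ; apart  = λ { zero zero () }
    }

  onLine-segment : ∀ {p q x} → Polyline.OnLine (segment p q) x → OnSeg p q x
  onLine-segment (zero , on) = on

  drawing : PlaneDrawing 8 (PGAdj 3)
  drawing = record
    { pos       = position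
    ; pos-inj   = position-injective
    ; arc       = λ u v _ → segment (position u) (position v)
    ; isArc     = λ u v (u≢v , _) → segment-isArc (λ same → u≢v (position-injective u v same))
    ; ends      = λ _ _ _ → refl , refl
    ; no-vertex = λ u v e w (on , w≢start , w≢end) →
        separated⇒disjoint
          (vertices-separated u v w (PGAdj⇒Edge e) (λ { refl → w≢start refl }) (λ { refl → w≢end refl }))
          (onLine-segment on) w≢start w≢end (onSeg-start (position w) (position w))
    ; no-cross  = λ u v e u′ v′ e′ not-same x (on , x≢u , x≢v) on′ →
        separated⇒disjoint (edges-separated u v u′ v′ (PGAdj⇒Edge e) (PGAdj⇒Edge e′) not-same)
          (onLine-segment on) x≢u x≢v (onLine-segment on′)
    }

open import Defs
open import Data.Nat using (ℕ; _≤_; _^_)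
open import Data.Product using (_×_; _,_)
open import Relation.Binary.PropositionalEquality using (_≡_; refl)
open import Relation.Nullary using (¬_)

mainTheorem1 : (n : ℕ) → 3 ≤ n →
    ((n ≡ 3) → Planar (2 ^ n) (PGAdj n)) × ((4 ≤ n) → ¬ Planar (2 ^ n) (PGAdj n))
mainTheorem1 n _ = planar , PowerGraphNonPlanar.power-graph-nonplanar n
  where
  planar : n ≡ 3 → Planar (2 ^ n) (PGAdj n)
  planar refl = DrawingOfG3.drawing
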